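{- Fix $p\in[0,1]$. For $n\ge0$ let $$P'_n(x,y,z,w)=\sum_{\pi\in[n]^n}\mathbb E\big[x^{\mathrm{unl}}y^{\mathrm{dis}}z^{\mathrm{des}}w^{\mathrm{rlm}}\,\mathbf 1\{\text{all $n$ cars park}\}\big],$$ with $P'_0=1$, where the expectation is over the coin flips of the probabilistic parking protocol with preference vector $\pi$ on a street with $n$ spots. Then for $n\ge1$, $$P'_n(x,y,z,w)=\big(1+p(xy+\cdots+xy^{n-1})\big)wP'_{n-1}(x,y,z,1)+\sum_{i=0}^{n-2}\binom{n-1}{i}\big(1+p(xy+\cdots+xy^{i})+(1-p)(xy+\cdots+xy^{n-i-1})\big)zw\,P'_i(x,y,z,1)\,P'_{n-i-1}(x,y,z,w).$$
   Context: Probabilistic parking protocol with parameter $p\in[0,1]$: spots $1,\dots,N$ on a street; cars $1,\dots,m$ arrive in order with preferences $\pi\in[N]^m$. A car goes to its preferred spot and parks there if it is unoccupied. Otherwise it flips an independent coin: with probability $p$ it moves forward and parks in the first unoccupied spot with larger label, with probability $1-p$ it moves backward and parks in the first unoccupied spot with smaller label; if there is no unoccupied spot in the chosen direction the car fails to park. (For $p=1$ this is the classical protocol.) On the event that all cars park, let $b_i$ be the spot of car $i$; $\mathrm{oc}=b_1\cdots b_m$. $\mathrm{unl}$ = number of cars with $b_i\ne\pi_i$; $\mathrm{dis}=\sum_i|b_i-\pi_i|$; when $m=N=n$, $\mathrm{des}$ and $\mathrm{rlm}$ are the numbers of descents (indices $i$ with $c_i>c_{i+1}$) and right-to-left maxima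 (indices $i$ with $c_i>c_j$ for all $j>i$) of $\mathrm{oc}^{ -1}=c_1\cdots c_n$. -}

module Defs where

open import Algebra.Bundles using (CommutativeRing)
open import Data.Nat using (ℕ; zero; suc; _∸_) renaming (_+_ to _+ℕ_)
open import Data.Nat using (∣_-_∣; _≡ᵇ_; _<ᵇ_)
open import Data.List using (List; []; _∷_; [_]; _++_; map; concatMap; upTo; downFrom)
open import Data.Bool.ListAction using (any; all)
open import Data.Maybe using (Maybe; just; nothing)
open import Data.Product using (_×_; _,_)
open import Data.Bool using (Bool; true; false; if_then_else_)

-- Spots are labelled 1..N (natural numbers); preferences take values in 1..N.

mem : ℕ → List ℕ → Bool
mem s = any (s ≡ᵇ_)

firstFree : List ℕ → List ℕ → Maybe ℕ
firstFree occ [] = nothing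
firstFree occ (s ∷ ss) = if mem s occ then firstFree occ ss else just s

-- outcome of the coin: no flip (preferred spot free), forward, backward
data Coin : Set where
  stay fwd bwd : Coin

fwdCount : Coin → ℕ
fwdCount fwd = 1
fwdCount _ = 0

bwdCount : Coin → ℕ
bwdCount bwd = 1
bwdCount _ = 0

opt : Coin → Maybe ℕ → List (Coin × ℕ)
opt c nothing = []
opt c (just s) = [ (c , s) ]

-- one car with preference a on a street with N spots, occupied spots occ:
-- the list of *successful* branches (coin outcome, spot where it parks).  Backward: first free among a-1, ..., 1.
-- Branches where the car fails to park are dropped (they contribute 0 to the
-- expectation of a quantity multiplied by 1{all cars park}).
step : ℕ → List ℕ → ℕ → List (Coin × ℕ)
step N occ a =
  if mem a occ
  then opt fwd (firstFree occ (map (λ k → a +ℕ suc k) (upTo (N ∸ a))))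
       ++ opt bwd (firstFree occ (map suc (downFrom (a ∸ 1))))
  else [ (stay , a) ]

-- run all cars with preference list π; returns the successful coin-flip
-- histories as (number of forward flips, number of backward flips, oc = b_1 ... b_m)
run : ℕ → List ℕ → List ℕ → List (ℕ × ℕ × List ℕ)
run N occ [] = [ (0 , 0 , []) ]
run N occ (a ∷ as) =
  concatMap (λ { (c , s) → map (λ { (f , b , bs) → (fwdCount c +ℕ f , bwdCount c +ℕ b , s ∷ bs) })
                                 (run N (s ∷ occ) as) })
            (step N occ a)

prefs : ℕ → ℕ → List (List ℕ)
prefs N zero = [ [] ]
prefs N (suc m) = concatMap (λ a → map (a ∷_) (prefs N m)) (map suc (upTo N))

unl : List ℕ → List ℕ → ℕ
unl (b ∷ bs) (a ∷ as) = (if b ≡ᵇ a then 0 else 1) +ℕ unl bs as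
unl _ _ = 0

dis : List ℕ → List ℕ → ℕ
dis (b ∷ bs) (a ∷ as) = ∣ b - a ∣ +ℕ dis bs as
dis _ _ = 0

-- 1-based position of j in a list
posOf : ℕ → List ℕ → ℕ
posOf j [] = 0
posOf j (b ∷ bs) = if b ≡ᵇ j then 1 else suc (posOf j bs)

-- inverse of the permutation oc of [n]: c_j = car parked in spot j
inv : ℕ → List ℕ → List ℕ
inv n oc = map (λ j → posOf j oc) (map suc (upTo n))

des : List ℕ → ℕ
des (a ∷ b ∷ r) = (if b <ᵇ a then 1 else 0) +ℕ des (b ∷ r)
des _ = 0

rlm : List ℕ → ℕ
rlm [] = 0
rlm (a ∷ r) = (if all (_<ᵇ a) r then 1 else 0) +ℕ rlm r

module Gen {c ℓ} (R : CommutativeRing c ℓ) where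
  open CommutativeRing R

  pow : Carrier → ℕ → Carrier
  pow u zero = 1#
  pow u (suc k) = u * pow u k

  sumR : List Carrier → Carrier
  sumR [] = 0#
  sumR (u ∷ us) = u + sumR us

  nat : ℕ → Carrier
  nat zero = 0#
  nat (suc k) = 1# + nat k

  xyGeom : Carrier → Carrier → ℕ → Carrier
  xyGeom x y i = sumR (map (λ k → x * pow y (suc k)) (upTo i))

  weight : Carrier → ℕ → Carrier → Carrier → Carrier → Carrier → List ℕ → ℕ × ℕ × List ℕ → Carrier
  weight p n x y z w π (f , b , oc) =
    pow p f * pow (1# + - p) b * pow x (unl oc π) * pow y (dis oc π)
      * pow z (des (inv n oc)) * pow w (rlm (inv n oc))

  P' : Carrier → ℕ → Carrier → Carrier → Carrier → Carrier → Carrier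
  P' p n x y z w = sumR (concatMap (λ π → map (weight p n x y z w π) (run n [] π)) (prefs n n))

module Submission where

-- Condition on the last car. After the first n cars have parked exactly one spot
-- j = l + 1 is free, and the last car parks there: forward from a preference a < j
-- (weight p x y^(j-a)), directly if a = j, backward from a > j (weight (1-p) x y^(a-j)).
-- Summed over a this gives 1 + p (xy + ... + xy^l) + (1-p) (xy + ... + xy^r), r = n - l.
-- As long as j is free no car crosses it, so the first n cars form two independent
-- processes on the l spots left of j and on the r spots right of j, interleaved in one
-- of C(n,l) ways, and unl, dis and the coin counts add up over the two sides.
-- In oc⁻¹ the last car n+1 sits at position j, preceded by the order-preservingly
-- relabelled inverse outcome of the left side and followed by that of the right side;
-- so des = des_L + [r > 0] + des_R and rlm = 1 + rlm_R, whence the factor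
-- z^[r>0] w P'_l(x,y,z,1) P'_r(x,y,z,w). The case r = 0 is the first summand.

open import Defs
open import Algebra.Bundles using (CommutativeRing)
open import Data.Nat using (ℕ; suc; _∸_)
open import Data.Nat.Combinatorics using (_C_)
open import Data.List using (map; upTo)
open import Data.List using ([])
open import Data.List.Relation.Unary.All.Properties using (all-upTo)
import Relation.Binary.PropositionalEquality as P
import Relation.Binary.Reasoning.Setoid as SetoidReasoning

module Parking where

  open import Data.Nat using (ℕ; zero; suc; _+_; _∸_; _≤_; _<_; z≤n; s≤s; _≡ᵇ_; _<ᵇ_; ∣_-_∣)
  open import Data.Nat.Properties
  open import Data.List using (List; []; _∷_; [_]; _++_; map; concatMap; upTo; downFrom; applyUpTo; applyDownFrom; length; reverse; _ʳ++_)
  open import Data.List.Properties using (map-upTo; map-downFrom; map-++; map-∘; length-applyUpTo; length-map; map-applyUpTo; map-applyDownFrom; map-cong-local)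
  open import Data.List.Relation.Unary.All using (All; []; _∷_)
  import Data.List.Relation.Unary.All as All
  open import Data.List.Relation.Unary.All.Properties using (++⁺; concat⁺; map⁺; map⁻; applyUpTo⁺₁; applyUpTo⁻; applyDownFrom⁺₁)
  open import Data.Maybe using (just; nothing) renaming (map to mapMaybe)
  open import Algebra.Properties.CommutativeSemigroup +-commutativeSemigroup using (interchange; x∙yz≈y∙xz)
  open import Data.Product using (_×_; _,_; proj₁; proj₂; ∃; ∃₂)
  open import Data.Bool using (Bool; true; false; if_then_else_; _∨_; not; _∧_)
  open import Data.Bool.Properties using (∨-comm; ∨-assoc; ∨-identityʳ; ∨-conicalˡ; ∨-conicalʳ)
  open import Data.Bool.ListAction using (all)
  open import Data.Empty using (⊥-elim)
  open import Data.Unit using (⊤; tt)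
  open import Data.Sum using (_⊎_; inj₁; inj₂)
  open import Relation.Binary.PropositionalEquality hiding ([_])
  open import Relation.Binary.Definitions using (tri<; tri≈; tri>)
  open import Function using (_∘_)

  ≡ᵇ-refl : ∀ n → (n ≡ᵇ n) ≡ true
  ≡ᵇ-refl zero = refl
  ≡ᵇ-refl (suc n) = ≡ᵇ-refl n

  ≡ᵇ-sym : ∀ m n → (m ≡ᵇ n) ≡ (n ≡ᵇ m)
  ≡ᵇ-sym zero zero = refl
  ≡ᵇ-sym zero (suc n) = refl
  ≡ᵇ-sym (suc m) zero = refl
  ≡ᵇ-sym (suc m) (suc n) = ≡ᵇ-sym m n

  ≡ᵇ-true⇒≡ : ∀ m n → (m ≡ᵇ n) ≡ true → m ≡ n
  ≡ᵇ-true⇒≡ zero zero e = refl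
  ≡ᵇ-true⇒≡ (suc m) (suc n) e = cong suc (≡ᵇ-true⇒≡ m n e)
  ≡ᵇ-true⇒≡ zero (suc n) ()
  ≡ᵇ-true⇒≡ (suc m) zero ()

  ≡ᵇ-false⇒≢ : ∀ {m n} → (m ≡ᵇ n) ≡ false → m ≢ n
  ≡ᵇ-false⇒≢ {m} e refl with trans (sym (≡ᵇ-refl m)) e
  ... | ()

  ≡ᵇ-cancelˡ-+ : ∀ j m n → (j + m ≡ᵇ j + n) ≡ (m ≡ᵇ n)
  ≡ᵇ-cancelˡ-+ zero m n = refl
  ≡ᵇ-cancelˡ-+ (suc j) m n = ≡ᵇ-cancelˡ-+ j m n

  <⇒≡ᵇ-false : ∀ {m n} → m < n → (m ≡ᵇ n) ≡ false
  <⇒≡ᵇ-false {zero} {suc n} _ = refl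
  <⇒≡ᵇ-false {suc m} {suc n} (s≤s p) = <⇒≡ᵇ-false p

  >⇒≡ᵇ-false : ∀ {m n} → n < m → (m ≡ᵇ n) ≡ false
  >⇒≡ᵇ-false {m} {n} p = trans (≡ᵇ-sym m n) (<⇒≡ᵇ-false p)

  <⇒<ᵇ-true : ∀ {m n} → m < n → (m <ᵇ n) ≡ true
  <⇒<ᵇ-true {zero} {suc n} _ = refl
  <⇒<ᵇ-true {suc m} {suc n} (s≤s p) = <⇒<ᵇ-true p

  ≥⇒<ᵇ-false : ∀ {m n} → n ≤ m → (m <ᵇ n) ≡ false
  ≥⇒<ᵇ-false {m} {zero} _ = refl
  ≥⇒<ᵇ-false {suc m} {suc n} (s≤s p) = ≥⇒<ᵇ-false p

  mem-ʳ++ : ∀ k oc occ → mem k (oc ʳ++ occ) ≡ (mem k oc ∨ mem k occ)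
  mem-ʳ++ k [] occ = refl
  mem-ʳ++ k (s ∷ oc) occ = trans (mem-ʳ++ k oc (s ∷ occ))
    (trans (sym (∨-assoc (mem k oc) (k ≡ᵇ s) (mem k occ)))
      (cong (_∨ mem k occ) (∨-comm (mem k oc) (k ≡ᵇ s))))

  mem-reverse : ∀ k oc → mem k (reverse oc) ≡ mem k oc
  mem-reverse k oc = trans (mem-ʳ++ k oc []) (∨-identityʳ (mem k oc))

  mem-map-+ : ∀ j k xs → mem (j + k) (map (j +_) xs) ≡ mem k xs
  mem-map-+ j k [] = refl
  mem-map-+ j k (x ∷ xs) = cong₂ _∨_ (≡ᵇ-cancelˡ-+ j k x) (mem-map-+ j k xs)

  applyUpTo-++ : ∀ {A : Set} (f : ℕ → A) m n → applyUpTo f (m + n) ≡ applyUpTo f m ++ applyUpTo (λ k → f (m + k)) n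
  applyUpTo-++ f zero n = refl
  applyUpTo-++ f (suc m) n = cong (f 0 ∷_) (applyUpTo-++ (f ∘ suc) m n)

  applyDownFrom-++ : ∀ {A : Set} (f : ℕ → A) n m → applyDownFrom f (n + m) ≡ applyDownFrom (λ k → f (k + m)) n ++ applyDownFrom f m
  applyDownFrom-++ f zero m = refl
  applyDownFrom-++ f (suc n) m = cong (f (n + m) ∷_) (applyDownFrom-++ f n m)

  applyUpTo-cong : ∀ {A : Set} {f g : ℕ → A} n → (∀ k → f k ≡ g k) → applyUpTo f n ≡ applyUpTo g n
  applyUpTo-cong zero e = refl
  applyUpTo-cong {f = f} {g} (suc n) e = cong₂ _∷_ (e 0) (applyUpTo-cong n (λ k → e (suc k)))

  applyDownFrom-cong : ∀ {A : Set} {f g : ℕ → A} n → (∀ k → f k ≡ g k) → applyDownFrom f n ≡ applyDownFrom g n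
  applyDownFrom-cong zero e = refl
  applyDownFrom-cong (suc n) e = cong₂ _∷_ (e n) (applyDownFrom-cong n e)

  -- One step and one run of the protocol

  firstFree-++-nothing : ∀ occ xs ys → firstFree occ xs ≡ nothing → firstFree occ (xs ++ ys) ≡ firstFree occ ys
  firstFree-++-nothing occ [] ys e = refl
  firstFree-++-nothing occ (x ∷ xs) ys e with mem x occ
  ... | true = firstFree-++-nothing occ xs ys e
  ... | false with e
  ... | ()

  firstFree-++-just : ∀ occ xs ys s → firstFree occ xs ≡ just s → firstFree occ (xs ++ ys) ≡ just s
  firstFree-++-just occ [] ys s ()
  firstFree-++-just occ (x ∷ xs) ys s e with mem x occ
  ... | true = firstFree-++-just occ xs ys s e
  ... | false = e

  firstFree-cong : ∀ {P : ℕ → Set} occ occ' xs → All P xs → (∀ k → P k → mem k occ ≡ mem k occ') → firstFree occ xs ≡ firstFree occ' xs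
  firstFree-cong occ occ' [] [] h = refl
  firstFree-cong occ occ' (x ∷ xs) (px ∷ pxs) h rewrite h x px with mem x occ'
  ... | true = firstFree-cong occ occ' xs pxs h
  ... | false = refl

  firstFree-occupied : ∀ occ xs → All (λ k → mem k occ ≡ true) xs → firstFree occ xs ≡ nothing
  firstFree-occupied occ [] [] = refl
  firstFree-occupied occ (x ∷ xs) (px ∷ pxs) rewrite px = firstFree-occupied occ xs pxs

  firstFree-free-∷ : ∀ occ s xs → mem s occ ≡ false → firstFree occ (s ∷ xs) ≡ just s
  firstFree-free-∷ occ s xs e rewrite e = refl

  firstFree-map-+ : ∀ {P : ℕ → Set} j occ occR xs → All P xs → (∀ k → P k → mem (j + k) occ ≡ mem k occR)
    → firstFree occ (map (j +_) xs) ≡ mapMaybe (j +_) (firstFree occR xs)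
  firstFree-map-+ j occ occR [] [] h = refl
  firstFree-map-+ j occ occR (x ∷ xs) (px ∷ pxs) h rewrite h x px with mem x occR
  ... | true = firstFree-map-+ j occ occR xs pxs h
  ... | false = refl

  firstFree-just : ∀ {P : ℕ → Set} occ xs s → All P xs → firstFree occ xs ≡ just s → P s × mem s occ ≡ false
  firstFree-just occ [] s [] ()
  firstFree-just occ (x ∷ xs) s (px ∷ pxs) e with mem x occ in eq
  ... | true = firstFree-just occ xs s pxs e
  ... | false with e
  ... | refl = px , eq

  Spot : ℕ → ℕ → Set
  Spot N k = (1 ≤ k) × (k ≤ N)

  spots : ℕ → List ℕ
  spots N = applyUpTo suc N

  All-spots : ∀ N → All (Spot N) (spots N)
  All-spots N = applyUpTo⁺₁ suc N (λ p → s≤s z≤n , p)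

  History : Set
  History = ℕ × ℕ × List ℕ

  outcome : History → List ℕ
  outcome (f , b , oc) = oc

  Fresh : ℕ → List ℕ → List ℕ → Set
  Fresh N occ [] = ⊤
  Fresh N occ (s ∷ oc) = (mem s occ ≡ false) × Spot N s × Fresh N (s ∷ occ) oc

  fwdCandidates : ℕ → ℕ → List ℕ
  fwdCandidates N a = applyUpTo (λ k → a + suc k) (N ∸ a)

  bwdCandidates : ℕ → List ℕ
  bwdCandidates a = applyDownFrom suc (a ∸ 1)

  fwdCandidates-eq : ∀ N a → map (λ k → a + suc k) (upTo (N ∸ a)) ≡ fwdCandidates N a
  fwdCandidates-eq N a = map-upTo (λ k → a + suc k) (N ∸ a)

  bwdCandidates-eq : ∀ a → map suc (downFrom (a ∸ 1)) ≡ bwdCandidates a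
  bwdCandidates-eq a = map-downFrom suc (a ∸ 1)

  stepCandidates : ℕ → List ℕ → ℕ → List (Coin × ℕ)
  stepCandidates N occ a = if mem a occ then opt fwd (firstFree occ (fwdCandidates N a)) ++ opt bwd (firstFree occ (bwdCandidates a)) else [ (stay , a) ]

  step≡stepCandidates : ∀ N occ a → step N occ a ≡ stepCandidates N occ a
  step≡stepCandidates N occ a rewrite fwdCandidates-eq N a | bwdCandidates-eq a = refl

  fwdCandidates-spots : ∀ N a → Spot N a → All (Spot N) (fwdCandidates N a)
  fwdCandidates-spots N a (_ , a≤N) = applyUpTo⁺₁ (λ k → a + suc k) (N ∸ a) λ {k} k< →
    ≤-trans (s≤s z≤n) (m≤n+m (suc k) a) , subst (a + suc k ≤_) (m+[n∸m]≡n a≤N) (+-monoʳ-≤ a k<)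

  All-opt : ∀ {P : Coin × ℕ → Set} c m → (∀ s → m ≡ just s → P (c , s)) → All P (opt c m)
  All-opt c nothing h = []
  All-opt c (just s) h = h s refl ∷ []

  bwdCandidates-spots : ∀ N a → Spot N a → All (Spot N) (bwdCandidates a)
  bwdCandidates-spots N a (_ , a≤N) = applyDownFrom⁺₁ suc (a ∸ 1) λ k< → s≤s z≤n , ≤-trans k< (≤-trans (m∸n≤m a 1) a≤N)

  LandsFree : ℕ → List ℕ → Coin × ℕ → Set
  LandsFree N occ cs = (mem (proj₂ cs) occ ≡ false) × Spot N (proj₂ cs)

  step-landsFree : ∀ N occ a → Spot N a → All (LandsFree N occ) (step N occ a)
  step-landsFree N occ a pa rewrite step≡stepCandidates N occ a with mem a occ in eq
  ... | false = (eq , pa) ∷ []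
  ... | true = ++⁺ (All-opt fwd _ (λ s e → let (ps , fr) = firstFree-just occ (fwdCandidates N a) s (fwdCandidates-spots N a pa) e in fr , ps))
                   (All-opt bwd _ (λ s e → let (ps , fr) = firstFree-just occ (bwdCandidates a) s (bwdCandidates-spots N a pa) e in fr , ps))

  ValidHistory : ℕ → List ℕ → List ℕ → History → Set
  ValidHistory N occ π h = Fresh N occ (outcome h) × length (outcome h) ≡ length π

  run-valid : ∀ N occ π → All (Spot N) π → All (ValidHistory N occ π) (run N occ π)
  run-valid N occ [] [] = (tt , refl) ∷ []
  run-valid N occ (a ∷ π) (pa ∷ pπ) =
    concat⁺ (map⁺ (All.map (λ {cs} ok → map⁺ (All.map (λ {h} r → (proj₁ ok , proj₂ ok , proj₁ r) , cong suc (proj₂ r)) (run-valid N (proj₂ cs ∷ occ) π pπ))) (step-landsFree N occ a pa)))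

  -- Counting occupied spots

  bit : Bool → ℕ
  bit true = 1
  bit false = 0

  countMem : List ℕ → List ℕ → ℕ
  countMem [] X = 0
  countMem (k ∷ ks) X = bit (mem k X) + countMem ks X

  countNotMem : List ℕ → List ℕ → ℕ
  countNotMem [] X = 0
  countNotMem (k ∷ ks) X = bit (not (mem k X)) + countNotMem ks X

  bit+bit-not : ∀ b → bit b + bit (not b) ≡ 1
  bit+bit-not true = refl
  bit+bit-not false = refl

  countMem+countNotMem : ∀ ks X → countMem ks X + countNotMem ks X ≡ length ks
  countMem+countNotMem [] X = refl
  countMem+countNotMem (k ∷ ks) X = trans (interchange (bit (mem k X)) (countMem ks X) (bit (not (mem k X))) (countNotMem ks X)) (cong₂ _+_ (bit+bit-not (mem k X)) (countMem+countNotMem ks X))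

  countMem≤length : ∀ ks X → countMem ks X ≤ length ks
  countMem≤length ks X = subst (countMem ks X ≤_) (countMem+countNotMem ks X) (m≤m+n _ _)

  countMem-full : ∀ ks X → countMem ks X ≡ length ks → All (λ k → mem k X ≡ true) ks
  countMem-full [] X e = []
  countMem-full (k ∷ ks) X e with mem k X in e'
  ... | true = e' ∷ countMem-full ks X (suc-injective e)
  ... | false = ⊥-elim (<-irrefl e (s≤s (countMem≤length ks X)))

  countMem-none : ∀ ks X → All (λ k → mem k X ≡ false) ks → countMem ks X ≡ 0
  countMem-none [] X [] = refl
  countMem-none (k ∷ ks) X (p ∷ ps) rewrite p = countMem-none ks X ps

  countMem-++ : ∀ xs ys X → countMem (xs ++ ys) X ≡ countMem xs X + countMem ys X
  countMem-++ [] ys X = refl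
  countMem-++ (x ∷ xs) ys X = trans (cong (bit (mem x X) +_) (countMem-++ xs ys X)) (sym (+-assoc (bit (mem x X)) (countMem xs X) (countMem ys X)))

  bit-mem-∷ : ∀ k s X → mem s X ≡ false → bit (mem k (s ∷ X)) ≡ bit (mem k [ s ]) + bit (mem k X)
  bit-mem-∷ k s X e with k ≡ᵇ s in e2
  ... | true rewrite ≡ᵇ-true⇒≡ k s e2 | e = refl
  ... | false = refl

  countMem-∷ : ∀ ks s X → mem s X ≡ false → countMem ks (s ∷ X) ≡ countMem ks [ s ] + countMem ks X
  countMem-∷ [] s X e = refl
  countMem-∷ (k ∷ ks) s X e = trans (cong₂ _+_ (bit-mem-∷ k s X e) (countMem-∷ ks s X e)) (interchange (bit (mem k [ s ])) (bit (mem k X)) (countMem ks [ s ]) (countMem ks X))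

  spots-split : ∀ l r → spots (suc l + r) ≡ spots l ++ suc l ∷ map (suc l +_) (spots r)
  spots-split l r = trans (cong spots (sym (+-suc l r))) (trans (applyUpTo-++ suc l (suc r))
    (cong (spots l ++_) (cong₂ _∷_ (cong suc (+-identityʳ l)) (sym (map-applyUpTo suc (suc l +_) r)))))

  mem-[]-< : ∀ {k s} → k < s → mem k [ s ] ≡ false
  mem-[]-< {k} {s} p rewrite <⇒≡ᵇ-false p = refl

  mem-[]-> : ∀ {k s} → s < k → mem k [ s ] ≡ false
  mem-[]-> {k} {s} p rewrite >⇒≡ᵇ-false p = refl

  spots-< : ∀ l → All (λ k → k < suc l) (spots l)
  spots-< l = applyUpTo⁺₁ suc l s≤s

  map-+-spots-> : ∀ j r → All (λ k → j < k) (map (j +_) (spots r))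
  map-+-spots-> j r = map⁺ (applyUpTo⁺₁ suc r (λ {k} p → subst (_≤ j + suc k) (+-suc j 0 ∙ cong suc (+-identityʳ j)) (+-monoʳ-≤ j {1} {suc k} (s≤s z≤n))))
    where
    _∙_ = trans

  spot-split : ∀ {s N} → Spot N s → ∃₂ (λ l r → (s ≡ suc l) × (N ≡ suc l + r))
  spot-split {suc l} {N} (_ , p) = l , (N ∸ suc l) , refl , sym (m+[n∸m]≡n p)

  countMem-singleton : ∀ N s → Spot N s → countMem (spots N) [ s ] ≡ 1
  countMem-singleton N s ps with spot-split ps
  ... | l , r , refl , refl = begin
    countMem (spots (suc l + r)) [ suc l ] ≡⟨ cong (λ z → countMem z [ suc l ]) (spots-split l r) ⟩
    countMem (spots l ++ suc l ∷ map (suc l +_) (spots r)) [ suc l ] ≡⟨ countMem-++ (spots l) (suc l ∷ map (suc l +_) (spots r)) [ suc l ] ⟩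
    countMem (spots l) [ suc l ] + (bit (mem (suc l) [ suc l ]) + countMem (map (suc l +_) (spots r)) [ suc l ])
      ≡⟨ cong₂ _+_ (countMem-none (spots l) [ suc l ] (All.map (λ {k} p → mem-[]-< p) (spots-< l)))
          (cong₂ _+_ (cong (λ b → bit (b ∨ false)) (≡ᵇ-refl l)) (countMem-none (map (suc l +_) (spots r)) [ suc l ] (All.map (λ {k} p → mem-[]-> p) (map-+-spots-> (suc l) r)))) ⟩
    1 ∎
    where open ≡-Reasoning

  countMem-cong : ∀ ks X Y → (∀ k → mem k X ≡ mem k Y) → countMem ks X ≡ countMem ks Y
  countMem-cong [] X Y h = refl
  countMem-cong (k ∷ ks) X Y h = cong₂ _+_ (cong bit (h k)) (countMem-cong ks X Y h)

  countMem-[] : ∀ ks → countMem ks [] ≡ 0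
  countMem-[] [] = refl
  countMem-[] (k ∷ ks) = countMem-[] ks

  countMem-fresh : ∀ N occ oc → Fresh N occ oc → countMem (spots N) (oc ʳ++ occ) ≡ length oc + countMem (spots N) occ
  countMem-fresh N occ [] tt = refl
  countMem-fresh N occ (s ∷ oc) (fr , ps , F) = trans (countMem-fresh N (s ∷ occ) oc F)
    (trans (cong (length oc +_) (trans (countMem-∷ (spots N) s occ fr) (cong (_+ countMem (spots N) occ) (countMem-singleton N s ps))))
      (+-suc (length oc) _))

  countMem-outcome : ∀ N oc → Fresh N [] oc → countMem (spots N) oc ≡ length oc
  countMem-outcome N oc F = trans (countMem-cong (spots N) oc (reverse oc) (λ k → sym (mem-reverse k oc)))
    (trans (countMem-fresh N [] oc F) (trans (cong (length oc +_) (countMem-[] (spots N))) (+-identityʳ _)))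

  length-spots : ∀ N → length (spots N) ≡ N
  length-spots N = length-applyUpTo suc N

  fresh-length≤ : ∀ N oc → Fresh N [] oc → length oc ≤ N
  fresh-length≤ N oc F = subst₂ _≤_ (countMem-outcome N oc F) (length-spots N) (countMem≤length (spots N) oc)

  All-spots⁻ : ∀ {P : ℕ → Set} N k → All P (spots N) → Spot N k → P k
  All-spots⁻ N (suc k) a (_ , q) = applyUpTo⁻ suc N a q

  fresh-full : ∀ N oc → Fresh N [] oc → length oc ≡ N → ∀ k → Spot N k → mem k oc ≡ true
  fresh-full N oc F e k pk = All-spots⁻ N k (countMem-full (spots N) oc (trans (countMem-outcome N oc F) (trans e (sym (length-spots N))))) pk

  oneSpotFree : ∀ n oc → Fresh (suc n) [] oc → length oc ≡ n → countNotMem (spots (suc n)) oc ≡ 1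
  oneSpotFree n oc F e = +-cancelˡ-≡ n _ _ (trans (cong (_+ countNotMem (spots (suc n)) oc) (sym (trans (countMem-outcome (suc n) oc F) e)))
    (trans (countMem+countNotMem (spots (suc n)) oc) (trans (length-spots (suc n)) (sym (+-suc n 0 ∙ cong suc (+-identityʳ n))))))
    where _∙_ = trans

  ≤-≤-+≡⇒≡ : ∀ {a b l r} → a ≤ l → b ≤ r → a + b ≡ l + r → (a ≡ l) × (b ≡ r)
  ≤-≤-+≡⇒≡ {a} {b} {l} {r} p q e with m≤n⇒m<n∨m≡n p
  ... | inj₂ refl = refl , +-cancelˡ-≡ a _ _ e
  ... | inj₁ lt = ⊥-elim (<-irrefl e (+-mono-<-≤ lt q))

  length-map-+-spots : ∀ j r → length (map (j +_) (spots r)) ≡ r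
  length-map-+-spots j r = trans (length-map (j +_) (spots r)) (length-spots r)

  otherSpotsOccupied : ∀ l r oc → Fresh (suc l + r) [] oc → length oc ≡ l + r → mem (suc l) oc ≡ false →
    (∀ k → Spot l k → mem k oc ≡ true) × (∀ k → Spot r k → mem (suc l + k) oc ≡ true)
  otherSpotsOccupied l r oc F e mj =
    let c = trans (sym (countMem-++ (spots l) (suc l ∷ map (suc l +_) (spots r)) oc))
              (trans (cong (λ z → countMem z oc) (sym (spots-split l r))) (trans (countMem-outcome (suc l + r) oc F) e))
        c' : countMem (spots l) oc + countMem (map (suc l +_) (spots r)) oc ≡ l + r
        c' = subst (λ b → countMem (spots l) oc + (bit b + countMem (map (suc l +_) (spots r)) oc) ≡ l + r) mj c
        (e1 , e2) = ≤-≤-+≡⇒≡ {countMem (spots l) oc} {countMem (map (suc l +_) (spots r)) oc} {l} {r}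
                           (subst (countMem (spots l) oc ≤_) (length-spots l) (countMem≤length (spots l) oc))
                           (subst (countMem (map (suc l +_) (spots r)) oc ≤_) (length-map-+-spots (suc l) r) (countMem≤length (map (suc l +_) (spots r)) oc)) c'
        a1 = countMem-full (spots l) oc (trans e1 (sym (length-spots l)))
        a2 = countMem-full (map (suc l +_) (spots r)) oc (trans e2 (sym (length-map-+-spots (suc l) r)))
    in (λ k pk → All-spots⁻ l k a1 pk) , (λ k pk → All-spots⁻ r k (map⁻ a2) pk)

  -- A free spot separates the street

  dropSpot : ℕ → List (Coin × ℕ) → List (Coin × ℕ)
  dropSpot j [] = []
  dropSpot j ((c , s) ∷ xs) = if j ≡ᵇ s then dropSpot j xs else (c , s) ∷ dropSpot j xs

  dropSpot-++ : ∀ j xs ys → dropSpot j (xs ++ ys) ≡ dropSpot j xs ++ dropSpot j ys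
  dropSpot-++ j [] ys = refl
  dropSpot-++ j ((c , s) ∷ xs) ys with j ≡ᵇ s
  ... | true = dropSpot-++ j xs ys
  ... | false = cong ((c , s) ∷_) (dropSpot-++ j xs ys)

  dropSpot-opt : ∀ j c m → (∀ s → m ≡ just s → (j ≡ᵇ s) ≡ false) → dropSpot j (opt c m) ≡ opt c m
  dropSpot-opt j c nothing h = refl
  dropSpot-opt j c (just s) h rewrite h s refl = refl

  shiftSpot : ℕ → Coin × ℕ → Coin × ℕ
  shiftSpot j (c , s) = (c , j + s)

  dropSpot-opt-shift : ∀ j c m → (∀ s → m ≡ just s → 1 ≤ s) → dropSpot j (opt c (mapMaybe (j +_) m)) ≡ map (shiftSpot j) (opt c m)
  dropSpot-opt-shift j c nothing h = refl
  dropSpot-opt-shift j c (just s) h rewrite <⇒≡ᵇ-false (m<m+n j (h s refl)) = refl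

  fwdCandidates-split : ∀ l r a → Spot l a → ∃ (λ rest → fwdCandidates (suc l + r) a ≡ fwdCandidates l a ++ suc l ∷ rest)
  fwdCandidates-split l r a (_ , a≤l) = applyUpTo (λ k → a + suc ((l ∸ a) + suc k)) r , eq
    where
    g = λ k → a + suc k
    e1 : (suc l + r) ∸ a ≡ (l ∸ a) + suc r
    e1 = trans (cong (_∸ a) (sym (+-suc l r))) (+-∸-comm (suc r) a≤l)
    e2 : g ((l ∸ a) + 0) ≡ suc l
    e2 = trans (cong g (+-identityʳ (l ∸ a))) (trans (+-suc a (l ∸ a)) (cong suc (m+[n∸m]≡n a≤l)))
    eq : fwdCandidates (suc l + r) a ≡ fwdCandidates l a ++ suc l ∷ applyUpTo (λ k → a + suc ((l ∸ a) + suc k)) r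
    eq = trans (cong (applyUpTo g) e1) (trans (applyUpTo-++ g (l ∸ a) (suc r)) (cong (λ z → fwdCandidates l a ++ z ∷ applyUpTo (λ k → a + suc ((l ∸ a) + suc k)) r) e2))

  -- occL and occR are the occupations of the streets [1..l] and [l+2..l+1+r],
  -- the latter relabelled to [1..r].
  Splits : ℕ → ℕ → List ℕ → List ℕ → List ℕ → Set
  Splits l r occ occL occR = (∀ k → Spot l k → mem k occ ≡ mem k occL) × (mem (suc l) occ ≡ false) × (∀ k → Spot r k → mem (suc l + k) occ ≡ mem k occR)

  Splits-[] : ∀ l r → Splits l r [] [] []
  Splits-[] l r = (λ k _ → refl) , refl , (λ k _ → refl)

  Splits-∷ˡ : ∀ l r {occ occL occR} s → Spot l s → Splits l r occ occL occR → Splits l r (s ∷ occ) (s ∷ occL) occR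
  Splits-∷ˡ l r {occ} s (_ , s≤l) (h1 , h2 , h3) =
    (λ k pk → cong ((k ≡ᵇ s) ∨_) (h1 k pk)) ,
    trans (cong (_∨ mem (suc l) occ) (>⇒≡ᵇ-false (s≤s s≤l))) h2 ,
    (λ k pk → trans (cong (_∨ mem (suc l + k) occ) (>⇒≡ᵇ-false (≤-trans (s≤s s≤l) (m≤m+n (suc l) k)))) (h3 k pk))

  Splits-∷ʳ : ∀ l r {occ occL occR} s → Spot r s → Splits l r occ occL occR → Splits l r ((suc l + s) ∷ occ) occL (s ∷ occR)
  Splits-∷ʳ l r {occ} s (1≤s , _) (h1 , h2 , h3) =
    (λ k pk → trans (cong (_∨ mem k occ) (<⇒≡ᵇ-false (≤-trans (s≤s (proj₂ pk)) (m≤m+n (suc l) s)))) (h1 k pk)) ,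
    trans (cong (_∨ mem (suc l) occ) (<⇒≡ᵇ-false (m<m+n (suc l) 1≤s))) h2 ,
    (λ k pk → cong₂ _∨_ (≡ᵇ-cancelˡ-+ (suc l) k s) (h3 k pk))

  -- While spot l+1 is free, a car preferring a spot to its left parks where it would
  -- on the street [1..l], except that leaving that street forward means parking on
  -- l+1: dropSpot removes exactly that branch. Symmetrically for step-right.
  step-left : ∀ l r occ occL occR a → Spot l a → Splits l r occ occL occR → dropSpot (suc l) (step (suc l + r) occ a) ≡ step l occL a
  step-left l r occ occL occR a pa@(_ , a≤l) rel@(h1 , h2 , h3)
    rewrite step≡stepCandidates (suc l + r) occ a | step≡stepCandidates l occL a | h1 a pa with mem a occL
  ... | false rewrite >⇒≡ᵇ-false {suc l} {a} (s≤s a≤l) = refl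
  ... | true with fwdCandidates-split l r a pa
  ... | rest , eqF rewrite eqF
      | firstFree-cong occ occL (bwdCandidates a) (bwdCandidates-spots l a pa) h1
      | dropSpot-++ (suc l) (opt fwd (firstFree occ (fwdCandidates l a ++ suc l ∷ rest))) (opt bwd (firstFree occL (bwdCandidates a)))
      | dropSpot-opt (suc l) bwd (firstFree occL (bwdCandidates a)) (λ s e → >⇒≡ᵇ-false (s≤s (proj₂ (proj₁ (firstFree-just occL (bwdCandidates a) s (bwdCandidates-spots l a pa) e)))))
      with firstFree occL (fwdCandidates l a) in eF
  ... | just s rewrite firstFree-++-just occ (fwdCandidates l a) (suc l ∷ rest) s (trans (firstFree-cong occ occL (fwdCandidates l a) (fwdCandidates-spots l a pa) h1) eF)
          | >⇒≡ᵇ-false {suc l} {s} (s≤s (proj₂ (proj₁ (firstFree-just occL (fwdCandidates l a) s (fwdCandidates-spots l a pa) eF)))) = refl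
  ... | nothing rewrite firstFree-++-nothing occ (fwdCandidates l a) (suc l ∷ rest) (trans (firstFree-cong occ occL (fwdCandidates l a) (fwdCandidates-spots l a pa) h1) eF)
          | firstFree-free-∷ occ (suc l) rest h2 | ≡ᵇ-refl l = refl

  fwdCandidates-shift : ∀ l r a → fwdCandidates (suc l + r) (suc l + a) ≡ map (suc l +_) (fwdCandidates r a)
  fwdCandidates-shift l r a = trans (cong (applyUpTo (λ k → (suc l + a) + suc k)) ([m+n]∸[m+o]≡n∸o (suc l) r a))
    (trans (applyUpTo-cong (r ∸ a) (λ k → +-assoc (suc l) a (suc k))) (sym (map-applyUpTo (λ k → a + suc k) (suc l +_) (r ∸ a))))

  bwdCandidates-split : ∀ l a → 1 ≤ a → ∃ (λ rest → bwdCandidates (suc l + a) ≡ map (suc l +_) (bwdCandidates a) ++ suc l ∷ rest)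
  bwdCandidates-split l (suc a') _ = applyDownFrom suc l , eq
    where
    eq : bwdCandidates (suc l + suc a') ≡ map (suc l +_) (bwdCandidates (suc a')) ++ suc l ∷ applyDownFrom suc l
    eq = trans (cong (applyDownFrom suc) (trans (+-suc l a') (trans (cong suc (+-comm l a')) (sym (+-suc a' l)))))
         (trans (applyDownFrom-++ suc a' (suc l))
           (cong (_++ suc l ∷ applyDownFrom suc l)
             (trans (applyDownFrom-cong a' (λ k → cong suc (trans (+-suc k l) (trans (cong suc (+-comm k l)) (sym (+-suc l k))))))
               (sym (map-applyDownFrom suc (suc l +_) a')))))

  step-right : ∀ l r occ occL occR a → Spot r a → Splits l r occ occL occR →
    dropSpot (suc l) (step (suc l + r) occ (suc l + a)) ≡ map (shiftSpot (suc l)) (step r occR a)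
  step-right l r occ occL occR a pa@(1≤a , _) rel@(h1 , h2 , h3)
    rewrite step≡stepCandidates (suc l + r) occ (suc l + a) | step≡stepCandidates r occR a | h3 a pa with mem a occR
  ... | false rewrite <⇒≡ᵇ-false (m<m+n (suc l) 1≤a) = refl
  ... | true with bwdCandidates-split l a 1≤a
  ... | rest , inv-rightPart rewrite inv-rightPart | fwdCandidates-shift l r a
      | firstFree-map-+ (suc l) occ occR (fwdCandidates r a) (fwdCandidates-spots r a pa) h3
      | map-++ (shiftSpot (suc l)) (opt fwd (firstFree occR (fwdCandidates r a))) (opt bwd (firstFree occR (bwdCandidates a)))
      | dropSpot-++ (suc l) (opt fwd (mapMaybe (suc l +_) (firstFree occR (fwdCandidates r a)))) (opt bwd (firstFree occ (map (suc l +_) (bwdCandidates a) ++ suc l ∷ rest)))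
      | dropSpot-opt-shift (suc l) fwd (firstFree occR (fwdCandidates r a)) (λ s e → proj₁ (proj₁ (firstFree-just occR (fwdCandidates r a) s (fwdCandidates-spots r a pa) e)))
      with firstFree occR (bwdCandidates a) in eB
  ... | just s rewrite firstFree-++-just occ (map (suc l +_) (bwdCandidates a)) (suc l ∷ rest) (suc l + s)
            (trans (firstFree-map-+ (suc l) occ occR (bwdCandidates a) (bwdCandidates-spots r a pa) h3) (cong (mapMaybe (suc l +_)) eB))
          | <⇒≡ᵇ-false (m<m+n (suc l) (proj₁ (proj₁ (firstFree-just occR (bwdCandidates a) s (bwdCandidates-spots r a pa) eB)))) = refl
  ... | nothing rewrite firstFree-++-nothing occ (map (suc l +_) (bwdCandidates a)) (suc l ∷ rest)
            (trans (firstFree-map-+ (suc l) occ occR (bwdCandidates a) (bwdCandidates-spots r a pa) h3) (cong (mapMaybe (suc l +_)) eB))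
          | firstFree-free-∷ occ (suc l) rest h2 | ≡ᵇ-refl l = refl

  step-free : ∀ N occ j → mem j occ ≡ false → step N occ j ≡ [ (stay , j) ]
  step-free N occ j e rewrite step≡stepCandidates N occ j | e = refl

  -- Interleavings and the statistics of an interleaved outcome

  data Side : Set where
    Lt Rt : Side

  patterns : ℕ → List (List Side)
  patterns zero = [ [] ]
  patterns (suc m) = map (Lt ∷_) (patterns m) ++ map (Rt ∷_) (patterns m)

  lefts : List Side → ℕ
  lefts [] = 0
  lefts (Lt ∷ p) = suc (lefts p)
  lefts (Rt ∷ p) = lefts p

  rights : List Side → ℕ
  rights [] = 0
  rights (Lt ∷ p) = rights p
  rights (Rt ∷ p) = suc (rights p)

  words : List ℕ → ℕ → List (List ℕ)
  words A zero = [ [] ]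
  words A (suc m) = concatMap (λ a → map (a ∷_) (words A m)) A

  interleave : {A : Set} → List Side → List A → List A → List A
  interleave [] xs ys = []
  interleave (Lt ∷ p) [] ys = interleave p [] ys
  interleave (Lt ∷ p) (x ∷ xs) ys = x ∷ interleave p xs ys
  interleave (Rt ∷ p) xs [] = interleave p xs []
  interleave (Rt ∷ p) xs (y ∷ ys) = y ∷ interleave p xs ys

  mergeHistory : ℕ → List Side → History → History → History
  mergeHistory j p (f , b , oc) (f' , b' , oc') = (f + f' , b + b' , interleave p oc (map (j +_) oc'))

  consHistory : Coin → ℕ → History → History
  consHistory c s (f , b , bs) = (fwdCount c + f , bwdCount c + b , s ∷ bs)

  -- leftIndex p t is the position in interleave p xs ys of the t-th entry of xs;
  -- 0, the value of posOf on an absent entry, is fixed.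
  leftIndex : List Side → ℕ → ℕ
  leftIndex [] t = t
  leftIndex (Lt ∷ p) zero = zero
  leftIndex (Lt ∷ p) (suc t) = suc (leftIndex p t)
  leftIndex (Rt ∷ p) zero = zero
  leftIndex (Rt ∷ p) (suc t) = suc (leftIndex p (suc t))

  rightIndex : List Side → ℕ → ℕ
  rightIndex [] t = t
  rightIndex (Rt ∷ p) zero = zero
  rightIndex (Rt ∷ p) (suc t) = suc (rightIndex p t)
  rightIndex (Lt ∷ p) zero = zero
  rightIndex (Lt ∷ p) (suc t) = suc (rightIndex p (suc t))

  leftIndex-0 : ∀ p → leftIndex p 0 ≡ 0
  leftIndex-0 [] = refl
  leftIndex-0 (Lt ∷ p) = refl
  leftIndex-0 (Rt ∷ p) = refl

  rightIndex-0 : ∀ p → rightIndex p 0 ≡ 0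
  rightIndex-0 [] = refl
  rightIndex-0 (Lt ∷ p) = refl
  rightIndex-0 (Rt ∷ p) = refl

  StrictlyIncreasing : (ℕ → ℕ) → Set
  StrictlyIncreasing f = ∀ {a b} → a < b → f a < f b

  leftIndex-increasing : ∀ p → StrictlyIncreasing (leftIndex p)
  leftIndex-increasing [] q = q
  leftIndex-increasing (Lt ∷ p) {zero} {suc b} q = s≤s z≤n
  leftIndex-increasing (Lt ∷ p) {suc a} {suc b} (s≤s q) = s≤s (leftIndex-increasing p q)
  leftIndex-increasing (Rt ∷ p) {zero} {suc b} q = s≤s z≤n
  leftIndex-increasing (Rt ∷ p) {suc a} {suc b} (s≤s q) = s≤s (leftIndex-increasing p (s≤s q))

  rightIndex-increasing : ∀ p → StrictlyIncreasing (rightIndex p)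
  rightIndex-increasing [] q = q
  rightIndex-increasing (Rt ∷ p) {zero} {suc b} q = s≤s z≤n
  rightIndex-increasing (Rt ∷ p) {suc a} {suc b} (s≤s q) = s≤s (rightIndex-increasing p q)
  rightIndex-increasing (Lt ∷ p) {zero} {suc b} q = s≤s z≤n
  rightIndex-increasing (Lt ∷ p) {suc a} {suc b} (s≤s q) = s≤s (rightIndex-increasing p (s≤s q))

  <ᵇ-increasing : ∀ f → StrictlyIncreasing f → ∀ a b → (f a <ᵇ f b) ≡ (a <ᵇ b)
  <ᵇ-increasing f m a b with <-cmp a b
  ... | tri< lt _ _ = trans (<⇒<ᵇ-true (m lt)) (sym (<⇒<ᵇ-true lt))
  ... | tri≈ _ refl _ = trans (≥⇒<ᵇ-false {f a} ≤-refl) (sym (≥⇒<ᵇ-false {a} ≤-refl))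
  ... | tri> _ _ gt = trans (≥⇒<ᵇ-false (<⇒≤ (m gt))) (sym (≥⇒<ᵇ-false (<⇒≤ gt)))

  des-map-increasing : ∀ f → StrictlyIncreasing f → ∀ xs → des (map f xs) ≡ des xs
  des-map-increasing f m [] = refl
  des-map-increasing f m (a ∷ []) = refl
  des-map-increasing f m (a ∷ b ∷ xs) = cong₂ (λ u v → (if u then 1 else 0) + v) (<ᵇ-increasing f m b a) (des-map-increasing f m (b ∷ xs))

  all-map-increasing : ∀ f → StrictlyIncreasing f → ∀ a xs → all (_<ᵇ f a) (map f xs) ≡ all (_<ᵇ a) xs
  all-map-increasing f m a [] = refl
  all-map-increasing f m a (x ∷ xs) = cong₂ _∧_ (<ᵇ-increasing f m x a) (all-map-increasing f m a xs)

  rlm-map-increasing : ∀ f → StrictlyIncreasing f → ∀ xs → rlm (map f xs) ≡ rlm xs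
  rlm-map-increasing f m [] = refl
  rlm-map-increasing f m (a ∷ xs) = cong₂ (λ u v → (if u then 1 else 0) + v) (all-map-increasing f m a xs) (rlm-map-increasing f m xs)

  posOf-suc : ∀ k x xs → ∃ (λ t → posOf k (x ∷ xs) ≡ suc t)
  posOf-suc k x xs with x ≡ᵇ k
  ... | true = 0 , refl
  ... | false = posOf k xs , refl

  mem⇒posOf-suc : ∀ k xs → mem k xs ≡ true → ∃ (λ t → posOf k xs ≡ suc t)
  mem⇒posOf-suc k [] ()
  mem⇒posOf-suc k (x ∷ xs) _ = posOf-suc k x xs

  ∨-resolveˡ : ∀ a b → a ≡ false → (a ∨ b) ≡ true → b ≡ true
  ∨-resolveˡ false b _ e = e

  posOf-interleave-left : ∀ p xs ys k → length xs ≡ lefts p → length ys ≡ rights p → mem k xs ≡ true → mem k ys ≡ false → posOf k (interleave p xs ys) ≡ leftIndex p (posOf k xs)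
  posOf-interleave-left [] [] ys k _ _ () _
  posOf-interleave-left (Lt ∷ p) [] ys k () _ _ _
  posOf-interleave-left (Lt ∷ p) (x ∷ xs) ys k lx ly mx my with x ≡ᵇ k in e
  ... | true = sym (cong suc (leftIndex-0 p))
  ... | false = cong suc (posOf-interleave-left p xs ys k (suc-injective lx) ly (∨-resolveˡ (k ≡ᵇ x) (mem k xs) (trans (≡ᵇ-sym k x) e) mx) my)
  posOf-interleave-left (Rt ∷ p) xs [] k _ () _ _
  posOf-interleave-left (Rt ∷ p) xs (y ∷ ys) k lx ly mx my
    rewrite trans (≡ᵇ-sym y k) (∨-conicalˡ (k ≡ᵇ y) (mem k ys) my) with mem⇒posOf-suc k xs mx
  ... | t , et rewrite et = cong suc (trans (posOf-interleave-left p xs ys k lx (suc-injective ly) mx (∨-conicalʳ (k ≡ᵇ y) (mem k ys) my)) (cong (leftIndex p) et))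

  posOf-interleave-right : ∀ p xs ys k → length xs ≡ lefts p → length ys ≡ rights p → mem k ys ≡ true → mem k xs ≡ false → posOf k (interleave p xs ys) ≡ rightIndex p (posOf k ys)
  posOf-interleave-right [] xs [] k _ _ () _
  posOf-interleave-right (Rt ∷ p) xs [] k _ () _ _
  posOf-interleave-right (Rt ∷ p) xs (y ∷ ys) k lx ly my mx with y ≡ᵇ k in e
  ... | true = sym (cong suc (rightIndex-0 p))
  ... | false = cong suc (posOf-interleave-right p xs ys k lx (suc-injective ly) (∨-resolveˡ (k ≡ᵇ y) (mem k ys) (trans (≡ᵇ-sym k y) e) my) mx)
  posOf-interleave-right (Lt ∷ p) [] ys k () _ _ _
  posOf-interleave-right (Lt ∷ p) (x ∷ xs) ys k lx ly my mx
    rewrite trans (≡ᵇ-sym x k) (∨-conicalˡ (k ≡ᵇ x) (mem k xs) mx) with mem⇒posOf-suc k ys my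
  ... | t , et rewrite et = cong suc (trans (posOf-interleave-right p xs ys k (suc-injective lx) ly my (∨-conicalʳ (k ≡ᵇ x) (mem k xs) mx)) (cong (rightIndex p) et))

  mem-interleave : ∀ p xs ys k → length xs ≡ lefts p → length ys ≡ rights p → mem k (interleave p xs ys) ≡ (mem k xs ∨ mem k ys)
  mem-interleave [] [] [] k _ _ = refl
  mem-interleave [] [] (y ∷ ys) k _ ()
  mem-interleave [] (x ∷ xs) ys k () _
  mem-interleave (Lt ∷ p) [] ys k () _
  mem-interleave (Lt ∷ p) (x ∷ xs) ys k lx ly = trans (cong ((k ≡ᵇ x) ∨_) (mem-interleave p xs ys k (suc-injective lx) ly)) (sym (∨-assoc (k ≡ᵇ x) (mem k xs) (mem k ys)))
  mem-interleave (Rt ∷ p) xs [] k _ ()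
  mem-interleave (Rt ∷ p) xs (y ∷ ys) k lx ly = trans (cong ((k ≡ᵇ y) ∨_) (mem-interleave p xs ys k lx (suc-injective ly)))
    (trans (sym (∨-assoc (k ≡ᵇ y) (mem k xs) (mem k ys))) (trans (cong (_∨ mem k ys) (∨-comm (k ≡ᵇ y) (mem k xs))) (∨-assoc (mem k xs) (k ≡ᵇ y) (mem k ys))))

  length-interleave : ∀ {A : Set} p (xs ys : List A) → length xs ≡ lefts p → length ys ≡ rights p → length (interleave p xs ys) ≡ lefts p + rights p
  length-interleave [] [] [] _ _ = refl
  length-interleave [] [] (y ∷ ys) _ ()
  length-interleave [] (x ∷ xs) ys () _
  length-interleave (Lt ∷ p) [] ys () _
  length-interleave (Lt ∷ p) (x ∷ xs) ys lx ly = cong suc (length-interleave p xs ys (suc-injective lx) ly)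
  length-interleave (Rt ∷ p) xs [] _ ()
  length-interleave (Rt ∷ p) xs (y ∷ ys) lx ly = trans (cong suc (length-interleave p xs ys lx (suc-injective ly))) (sym (+-suc (lefts p) (rights p)))

  zipSum : (ℕ → ℕ → ℕ) → List ℕ → List ℕ → ℕ
  zipSum f (b ∷ bs) (a ∷ as) = f b a + zipSum f bs as
  zipSum f _ _ = 0

  unl≡zipSum : ∀ bs as → unl bs as ≡ zipSum (λ b a → if b ≡ᵇ a then 0 else 1) bs as
  unl≡zipSum [] as = refl
  unl≡zipSum (b ∷ bs) [] = refl
  unl≡zipSum (b ∷ bs) (a ∷ as) = cong (_ +_) (unl≡zipSum bs as)

  dis≡zipSum : ∀ bs as → dis bs as ≡ zipSum ∣_-_∣ bs as
  dis≡zipSum [] as = refl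
  dis≡zipSum (b ∷ bs) [] = refl
  dis≡zipSum (b ∷ bs) (a ∷ as) = cong (_ +_) (dis≡zipSum bs as)

  zipSum-interleave : ∀ f p xs ys us vs → length xs ≡ lefts p → length us ≡ lefts p → length ys ≡ rights p → length vs ≡ rights p →
    zipSum f (interleave p xs ys) (interleave p us vs) ≡ zipSum f xs us + zipSum f ys vs
  zipSum-interleave f [] [] [] [] [] _ _ _ _ = refl
  zipSum-interleave f [] [] [] [] (d ∷ vs) _ _ _ ()
  zipSum-interleave f [] [] (b ∷ ys) us vs _ _ () _
  zipSum-interleave f [] (a ∷ xs) ys us vs () _ _ _
  zipSum-interleave f (Lt ∷ p) [] ys us vs () _ _ _
  zipSum-interleave f (Lt ∷ p) (a ∷ xs) ys [] vs _ () _ _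
  zipSum-interleave f (Lt ∷ p) (a ∷ xs) ys (c ∷ us) vs la lc lb ld =
    trans (cong (f a c +_) (zipSum-interleave f p xs ys us vs (suc-injective la) (suc-injective lc) lb ld)) (sym (+-assoc (f a c) (zipSum f xs us) (zipSum f ys vs)))
  zipSum-interleave f (Rt ∷ p) xs [] us vs _ _ () _
  zipSum-interleave f (Rt ∷ p) xs (b ∷ ys) us [] _ _ _ ()
  zipSum-interleave f (Rt ∷ p) xs (b ∷ ys) us (d ∷ vs) la lc lb ld =
    trans (cong (f b d +_) (zipSum-interleave f p xs ys us vs la lc (suc-injective lb) (suc-injective ld))) (x∙yz≈y∙xz (f b d) (zipSum f xs us) (zipSum f ys vs))

  zipSum-map-+ : ∀ f j → (∀ b a → f (j + b) (j + a) ≡ f b a) → ∀ B D → zipSum f (map (j +_) B) (map (j +_) D) ≡ zipSum f B D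
  zipSum-map-+ f j h [] D = refl
  zipSum-map-+ f j h (b ∷ B) [] = refl
  zipSum-map-+ f j h (b ∷ B) (d ∷ D) = cong₂ _+_ (h b d) (zipSum-map-+ f j h B D)

  zipSum-∷ʳ : ∀ f bs as b a → length bs ≡ length as → zipSum f (bs ++ [ b ]) (as ++ [ a ]) ≡ zipSum f bs as + (f b a + 0)
  zipSum-∷ʳ f [] [] b a _ = refl
  zipSum-∷ʳ f (x ∷ bs) (y ∷ as) b a e = trans (cong (f x y +_) (zipSum-∷ʳ f bs as b a (suc-injective e))) (sym (+-assoc (f x y) _ _))

  mismatch-shift : ∀ j b a → (if (j + b) ≡ᵇ (j + a) then 0 else 1) ≡ (if b ≡ᵇ a then 0 else 1)
  mismatch-shift j b a = cong (λ u → if u then 0 else 1) (≡ᵇ-cancelˡ-+ j b a)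

  unl-∷ʳ : ∀ oc π j a → length oc ≡ length π → unl (oc ++ [ j ]) (π ++ [ a ]) ≡ unl oc π + unl [ j ] [ a ]
  unl-∷ʳ oc π j a e = trans (unl≡zipSum (oc ++ [ j ]) (π ++ [ a ])) (trans (zipSum-∷ʳ _ oc π j a e) (cong (_+ _) (sym (unl≡zipSum oc π))))

  dis-∷ʳ : ∀ oc π j a → length oc ≡ length π → dis (oc ++ [ j ]) (π ++ [ a ]) ≡ dis oc π + dis [ j ] [ a ]
  dis-∷ʳ oc π j a e = trans (dis≡zipSum (oc ++ [ j ]) (π ++ [ a ])) (trans (zipSum-∷ʳ _ oc π j a e) (cong (_+ _) (sym (dis≡zipSum oc π))))

  zipSum-interleave-shift : ∀ f l pt ocL ocR πL πR → (∀ b a → f (suc l + b) (suc l + a) ≡ f b a) →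
    length ocL ≡ lefts pt → length πL ≡ lefts pt → length ocR ≡ rights pt → length πR ≡ rights pt →
    zipSum f (interleave pt ocL (map (suc l +_) ocR)) (interleave pt πL (map (suc l +_) πR)) ≡ zipSum f ocL πL + zipSum f ocR πR
  zipSum-interleave-shift f l pt ocL ocR πL πR hf lenOcL lenπL lenOcR lenπR =
    trans (zipSum-interleave f pt ocL (map (suc l +_) ocR) πL (map (suc l +_) πR) lenOcL lenπL
              (trans (length-map _ ocR) lenOcR) (trans (length-map _ πR) lenπR))
            (cong (zipSum f ocL πL +_) (zipSum-map-+ f (suc l) hf ocR πR))

  posOf-map-+ : ∀ j k ys → posOf (j + k) (map (j +_) ys) ≡ posOf k ys
  posOf-map-+ j k [] = refl
  posOf-map-+ j k (y ∷ ys) rewrite ≡ᵇ-cancelˡ-+ j y k = cong (λ u → if y ≡ᵇ k then 1 else suc u) (posOf-map-+ j k ys)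

  posOf-∷ʳ : ∀ k X j → mem k X ≡ true → posOf k (X ++ [ j ]) ≡ posOf k X
  posOf-∷ʳ k [] j ()
  posOf-∷ʳ k (x ∷ X) j m with x ≡ᵇ k in e
  ... | true = refl
  ... | false = cong suc (posOf-∷ʳ k X j (∨-resolveˡ (k ≡ᵇ x) (mem k X) (trans (≡ᵇ-sym k x) e) m))

  posOf-∷ʳ-last : ∀ X j → mem j X ≡ false → posOf j (X ++ [ j ]) ≡ suc (length X)
  posOf-∷ʳ-last [] j m rewrite ≡ᵇ-refl j = refl
  posOf-∷ʳ-last (x ∷ X) j m rewrite trans (≡ᵇ-sym x j) (∨-conicalˡ (j ≡ᵇ x) (mem j X) m) = cong suc (posOf-∷ʳ-last X j (∨-conicalʳ (j ≡ᵇ x) (mem j X) m))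

  posOf≤length : ∀ k X → mem k X ≡ true → posOf k X ≤ length X
  posOf≤length k [] ()
  posOf≤length k (x ∷ X) m with x ≡ᵇ k in e
  ... | true = s≤s z≤n
  ... | false = s≤s (posOf≤length k X (∨-resolveˡ (k ≡ᵇ x) (mem k X) (trans (≡ᵇ-sym k x) e) m))

  fresh-spots : ∀ N occ oc → Fresh N occ oc → All (Spot N) oc
  fresh-spots N occ [] _ = []
  fresh-spots N occ (s ∷ oc) (_ , ps , F) = ps ∷ fresh-spots N (s ∷ occ) oc F

  mem-outside : ∀ {l k} xs → All (Spot l) xs → (k ≡ 0 ⊎ l < k) → mem k xs ≡ false
  mem-outside [] [] _ = refl
  mem-outside {l} {k} (x ∷ xs) ((1≤x , x≤l) ∷ ps) h = trans (cong (_∨ mem k xs) (lem h)) (mem-outside xs ps h)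
    where
    lem : (k ≡ 0 ⊎ l < k) → (k ≡ᵇ x) ≡ false
    lem (inj₁ refl) = <⇒≡ᵇ-false 1≤x
    lem (inj₂ lt) = >⇒≡ᵇ-false (≤-trans (s≤s x≤l) lt)

  bit-<ᵇ-false : ∀ {a b} → a < b → (if b <ᵇ a then 1 else 0) ≡ 0
  bit-<ᵇ-false {a} {b} p rewrite ≥⇒<ᵇ-false {b} {a} (<⇒≤ p) = refl

  des-++ : ∀ A x B → des (A ++ x ∷ B) ≡ des (A ++ [ x ]) + des (x ∷ B)
  des-++ [] x B = refl
  des-++ (a ∷ []) x B = sym (cong (_+ des (x ∷ B)) (+-identityʳ _))
  des-++ (a ∷ b ∷ A) x B = trans (cong (_ +_) (des-++ (b ∷ A) x B)) (sym (+-assoc (if b <ᵇ a then 1 else 0) (des ((b ∷ A) ++ [ x ])) (des (x ∷ B))))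

  des-∷ʳ-max : ∀ A x → All (_< x) A → des (A ++ [ x ]) ≡ des A
  des-∷ʳ-max [] x _ = refl
  des-∷ʳ-max (a ∷ []) x (p ∷ []) = cong (_+ 0) (bit-<ᵇ-false p)
  des-∷ʳ-max (a ∷ b ∷ A) x (p ∷ ps) = cong (_ +_) (des-∷ʳ-max (b ∷ A) x ps)

  sgn : ℕ → ℕ
  sgn zero = 0
  sgn (suc _) = 1

  sgn-∸ : ∀ {k n} → k < n → sgn (n ∸ k) ≡ 1
  sgn-∸ {zero} {suc n} _ = refl
  sgn-∸ {suc k} {suc n} (s≤s lt) = sgn-∸ lt

  des-∷-max : ∀ x B → All (_< x) B → des (x ∷ B) ≡ sgn (length B) + des B
  des-∷-max x [] [] = refl
  des-∷-max x (b ∷ B) (p ∷ ps) rewrite <⇒<ᵇ-true p = refl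

  all-false : ∀ (P : ℕ → Bool) A x B → P x ≡ false → all P (A ++ x ∷ B) ≡ false
  all-false P [] x B e rewrite e = refl
  all-false P (a ∷ A) x B e rewrite all-false P A x B e with P a
  ... | true = refl
  ... | false = refl

  all-<ᵇ-true : ∀ x B → All (_< x) B → all (_<ᵇ x) B ≡ true
  all-<ᵇ-true x [] [] = refl
  all-<ᵇ-true x (b ∷ B) (p ∷ ps) rewrite <⇒<ᵇ-true p = all-<ᵇ-true x B ps

  rlm-++-below : ∀ A x B → All (_< x) A → rlm (A ++ x ∷ B) ≡ rlm (x ∷ B)
  rlm-++-below [] x B _ = refl
  rlm-++-below (a ∷ A) x B (p ∷ ps) rewrite all-false (_<ᵇ a) A x B (≥⇒<ᵇ-false (<⇒≤ p)) = rlm-++-below A x B ps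

  rlm-∷-max : ∀ x B → All (_< x) B → rlm (x ∷ B) ≡ suc (rlm B)
  rlm-∷-max x B ps rewrite all-<ᵇ-true x B ps = refl

  des-++-max : ∀ A x B → All (_< x) A → All (_< x) B → des (A ++ x ∷ B) ≡ des A + sgn (length B) + des B
  des-++-max A x B A<x B<x = begin
    des (A ++ x ∷ B)                  ≡⟨ des-++ A x B ⟩
    des (A ++ [ x ]) + des (x ∷ B)    ≡⟨ cong₂ _+_ (des-∷ʳ-max A x A<x) (des-∷-max x B B<x) ⟩
    des A + (sgn (length B) + des B)  ≡⟨ sym (+-assoc (des A) _ (des B)) ⟩
    des A + sgn (length B) + des B    ∎
    where open ≡-Reasoning

  rlm-++-max : ∀ A x B → All (_< x) A → All (_< x) B → rlm (A ++ x ∷ B) ≡ suc (rlm B)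
  rlm-++-max A x B A<x B<x = trans (rlm-++-below A x B A<x) (rlm-∷-max x B B<x)

  mem-none : ∀ k ys → All (λ y → (k ≡ᵇ y) ≡ false) ys → mem k ys ≡ false
  mem-none k [] [] = refl
  mem-none k (y ∷ ys) (e ∷ es) rewrite e = mem-none k ys es

  inv-spots : ∀ n X → inv n X ≡ map (λ k → posOf k X) (spots n)
  inv-spots n X = cong (map (λ k → posOf k X)) (map-upTo suc n)

  length-inv : ∀ n X → length (inv n X) ≡ n
  length-inv n X = trans (length-map _ (map suc (upTo n))) (trans (cong length (map-upTo suc n)) (length-spots n))

  -- X is the outcome of all cars when the last one parks on the free spot l+1. In inv X
  -- that car is the maximal entry, at position l+1, with the relabelled inverse outcomes
  -- of the two sides before and after it.
  module InverseOfInterleaving (l r : ℕ) (p : List Side) (ocL ocR : List ℕ) (eL : lefts p ≡ l) (eR : rights p ≡ r)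
    (FL : Fresh l [] ocL) (lL : length ocL ≡ l) (FR : Fresh r [] ocR) (lR : length ocR ≡ r) where
    j = suc l
    shiftedR = map (j +_) ocR
    M = interleave p ocL shiftedR
    X = M ++ [ j ]
    posX = λ k → posOf k X
    lxs : length ocL ≡ lefts p
    lxs = trans lL (sym eL)
    lys : length shiftedR ≡ rights p
    lys = trans (length-map (j +_) ocR) (trans lR (sym eR))
    lenM : length M ≡ l + r
    lenM = trans (length-interleave p ocL shiftedR lxs lys) (cong₂ _+_ eL eR)
    pL = fresh-spots l [] ocL FL
    pR = fresh-spots r [] ocR FR
    mem-shiftedR-small : ∀ k → k < suc j → mem k shiftedR ≡ false
    mem-shiftedR-small k k< = mem-none k shiftedR (map⁺ (All.map (λ {s} ps → <⇒≡ᵇ-false (≤-trans k< (subst (_≤ j + s) (+-comm j 1) (+-monoʳ-≤ j (proj₁ ps))))) pR))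
    mem-ocL-large : ∀ k → l < k → mem k ocL ≡ false
    mem-ocL-large k lt = mem-outside ocL pL (inj₂ lt)
    posX-left : ∀ k → Spot l k → (posX k ≡ leftIndex p (posOf k ocL)) × (posX k < suc (l + r))
    posX-left k pk@(_ , k≤l) =
      let mL = fresh-full l ocL FL lL k pk
          mR = mem-shiftedR-small k (s≤s (m≤n⇒m≤1+n k≤l))
          mM = trans (mem-interleave p ocL shiftedR k lxs lys) (cong (_∨ mem k shiftedR) mL)
          e1 = posOf-∷ʳ k M j mM
      in trans e1 (posOf-interleave-left p ocL shiftedR k lxs lys mL mR) , s≤s (subst (posX k ≤_) lenM (subst (_≤ length M) (sym e1) (posOf≤length k M mM)))
    posX-right : ∀ k → Spot r k → (posX (j + k) ≡ rightIndex p (posOf k ocR)) × (posX (j + k) < suc (l + r))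
    posX-right k pk@(1≤k , _) =
      let mR = trans (mem-map-+ j k ocR) (fresh-full r ocR FR lR k pk)
          mL = mem-ocL-large (j + k) (m≤m+n (suc l) k)
          mM = trans (mem-interleave p ocL shiftedR (j + k) lxs lys) (trans (cong (mem (j + k) ocL ∨_) mR) (∨-comm _ true))
          e1 = posOf-∷ʳ (j + k) M j mM
      in trans e1 (trans (posOf-interleave-right p ocL shiftedR (j + k) lxs lys mR mL) (cong (rightIndex p) (posOf-map-+ j k ocR))) ,
         s≤s (subst (posX (j + k) ≤_) lenM (subst (_≤ length M) (sym e1) (posOf≤length (j + k) M mM)))
    posX-lastCar : posX j ≡ suc (l + r)
    posX-lastCar = trans (posOf-∷ʳ-last M j (trans (mem-interleave p ocL shiftedR j lxs lys) (cong₂ _∨_ (mem-ocL-large j ≤-refl) (mem-shiftedR-small j (n<1+n j))))) (cong suc lenM)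
    A' = map (leftIndex p) (inv l ocL)
    B' = map (rightIndex p) (inv r ocR)
    inv-leftPart : map posX (spots l) ≡ A'
    inv-leftPart = trans (map-cong-local (All.map (λ {k} pk → proj₁ (posX-left k pk)) (All-spots l)))
            (trans (map-∘ (spots l)) (cong (map (leftIndex p)) (sym (inv-spots l ocL))))
    inv-rightPart : map posX (map (j +_) (spots r)) ≡ B'
    inv-rightPart = trans (sym (map-∘ (spots r))) (trans (map-cong-local (All.map (λ {k} pk → proj₁ (posX-right k pk)) (All-spots r)))
            (trans (map-∘ (spots r)) (cong (map (rightIndex p)) (sym (inv-spots r ocR)))))
    boundA : All (_< suc (l + r)) A'
    boundA = subst (All (_< suc (l + r))) inv-leftPart (map⁺ (All.map (λ {k} pk → proj₂ (posX-left k pk)) (All-spots l)))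
    boundB : All (_< suc (l + r)) B'
    boundB = subst (All (_< suc (l + r))) inv-rightPart (map⁺ (map⁺ (All.map (λ {k} pk → proj₂ (posX-right k pk)) (All-spots r))))
    inv-decomposition : inv (suc l + r) X ≡ A' ++ suc (l + r) ∷ B'
    inv-decomposition = trans (inv-spots (suc l + r) X) (trans (cong (map posX) (spots-split l r))
             (trans (map-++ posX (spots l) (j ∷ map (j +_) (spots r))) (cong₂ _++_ inv-leftPart (cong₂ _∷_ posX-lastCar inv-rightPart))))
    lenB : length B' ≡ r
    lenB = trans (length-map (rightIndex p) (inv r ocR)) (length-inv r ocR)
    des-inv-interleaving : des (inv (suc l + r) X) ≡ des (inv l ocL) + sgn r + des (inv r ocR)
    des-inv-interleaving = begin
      des (inv (suc l + r) X)             ≡⟨ cong des inv-decomposition ⟩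
      des (A' ++ suc (l + r) ∷ B')        ≡⟨ des-++-max A' _ B' boundA boundB ⟩
      des A' + sgn (length B') + des B'   ≡⟨ cong₂ _+_ (cong₂ _+_ desA (cong sgn lenB)) desB ⟩
      des (inv l ocL) + sgn r + des (inv r ocR) ∎
      where
      open ≡-Reasoning
      desA = des-map-increasing (leftIndex p) (leftIndex-increasing p) (inv l ocL)
      desB = des-map-increasing (rightIndex p) (rightIndex-increasing p) (inv r ocR)

    rlm-inv-interleaving : rlm (inv (suc l + r) X) ≡ suc (rlm (inv r ocR))
    rlm-inv-interleaving = trans (cong rlm inv-decomposition)
      (trans (rlm-++-max A' _ B' boundA boundB) (cong suc (rlm-map-increasing (rightIndex p) (rightIndex-increasing p) (inv r ocR))))

  module LastCar (l r : ℕ) (X : List ℕ) (h1 : ∀ k → Spot l k → mem k X ≡ true) (h2 : mem (suc l) X ≡ false)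
    (h3 : ∀ k → Spot r k → mem (suc l + k) X ≡ true) where

    step-last-left : ∀ a → Spot l a → step (suc l + r) X a ≡ [ (fwd , suc l) ]
    step-last-left a pa with fwdCandidates-split l r a pa
    ... | rest , eqF rewrite step≡stepCandidates (suc l + r) X a | h1 a pa | eqF
        | firstFree-++-nothing X (fwdCandidates l a) (suc l ∷ rest) (firstFree-occupied X (fwdCandidates l a) (All.map (h1 _) (fwdCandidates-spots l a pa)))
        | firstFree-free-∷ X (suc l) rest h2
        | firstFree-occupied X (bwdCandidates a) (All.map (h1 _) (bwdCandidates-spots l a pa)) = refl

    step-last-right : ∀ a → Spot r a → step (suc l + r) X (suc l + a) ≡ [ (bwd , suc l) ]
    step-last-right a pa with bwdCandidates-split l a (proj₁ pa)
    ... | rest , inv-rightPart rewrite step≡stepCandidates (suc l + r) X (suc l + a) | h3 a pa | inv-rightPart | fwdCandidates-shift l r a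
        | firstFree-occupied X (map (suc l +_) (fwdCandidates r a)) (map⁺ (All.map (h3 _) (fwdCandidates-spots r a pa)))
        | firstFree-++-nothing X (map (suc l +_) (bwdCandidates a)) (suc l ∷ rest) (firstFree-occupied X (map (suc l +_) (bwdCandidates a)) (map⁺ (All.map (h3 _) (bwdCandidates-spots r a pa))))
        | firstFree-free-∷ X (suc l) rest h2 = refl

    step-last-free : step (suc l + r) X (suc l) ≡ [ (stay , suc l) ]
    step-last-free = step-free (suc l + r) X (suc l) h2

module FiniteSum {c ℓ} (R : CommutativeRing c ℓ) where

  open CommutativeRing R
  open Gen R
  open import Data.List using (List; []; _∷_; _++_; map; concatMap)
  open import Data.List.Relation.Unary.All using (All; []; _∷_)
  open import Data.Bool using (Bool; true; false; if_then_else_)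
  import Relation.Binary.PropositionalEquality as P
  open import Function using (_∘_)
  open import Algebra.Properties.CommutativeSemigroup +-commutativeSemigroup using (interchange)

  ∑ : ∀ {a} {A : Set a} → List A → (A → Carrier) → Carrier
  ∑ [] f = 0#
  ∑ (x ∷ xs) f = f x + ∑ xs f

  sumR-map≡∑ : ∀ {a} {A : Set a} (xs : List A) f → sumR (map f xs) P.≡ ∑ xs f
  sumR-map≡∑ [] f = P.refl
  sumR-map≡∑ (x ∷ xs) f = P.cong (f x +_) (sumR-map≡∑ xs f)

  ∑-cong : ∀ {a} {A : Set a} (xs : List A) {f g : A → Carrier} → (∀ x → f x ≈ g x) → ∑ xs f ≈ ∑ xs g
  ∑-cong [] h = refl
  ∑-cong (x ∷ xs) h = +-cong (h x) (∑-cong xs h)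

  ∑-cong-All : ∀ {a p} {A : Set a} {P : A → Set p} (xs : List A) {f g : A → Carrier} → All P xs → (∀ x → P x → f x ≈ g x) → ∑ xs f ≈ ∑ xs g
  ∑-cong-All [] [] h = refl
  ∑-cong-All (x ∷ xs) (px ∷ pxs) h = +-cong (h x px) (∑-cong-All xs pxs h)

  ∑-++ : ∀ {a} {A : Set a} (xs ys : List A) f → ∑ (xs ++ ys) f ≈ ∑ xs f + ∑ ys f
  ∑-++ [] ys f = sym (+-identityˡ _)
  ∑-++ (x ∷ xs) ys f = trans (+-congˡ (∑-++ xs ys f)) (sym (+-assoc _ _ _))

  ∑-map : ∀ {a b} {A : Set a} {B : Set b} (h : A → B) (xs : List A) f → ∑ (map h xs) f P.≡ ∑ xs (f ∘ h)
  ∑-map h [] f = P.refl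
  ∑-map h (x ∷ xs) f = P.cong (f (h x) +_) (∑-map h xs f)

  ∑-concatMap : ∀ {a b} {A : Set a} {B : Set b} (g : A → List B) (xs : List A) f → ∑ (concatMap g xs) f ≈ ∑ xs (λ x → ∑ (g x) f)
  ∑-concatMap g [] f = refl
  ∑-concatMap g (x ∷ xs) f = trans (∑-++ (g x) (concatMap g xs) f) (+-congˡ (∑-concatMap g xs f))

  ∑-0 : ∀ {a} {A : Set a} (xs : List A) → ∑ xs (λ _ → 0#) ≈ 0#
  ∑-0 [] = refl
  ∑-0 (x ∷ xs) = trans (+-identityˡ _) (∑-0 xs)

  ∑-+ : ∀ {a} {A : Set a} (xs : List A) f g → ∑ xs (λ x → f x + g x) ≈ ∑ xs f + ∑ xs g
  ∑-+ [] f g = sym (+-identityˡ _)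
  ∑-+ (x ∷ xs) f g = trans (+-congˡ (∑-+ xs f g)) (interchange (f x) (g x) (∑ xs f) (∑ xs g))

  ∑-swap : ∀ {a b} {A : Set a} {B : Set b} (xs : List A) (ys : List B) (f : A → B → Carrier) →
    ∑ xs (λ x → ∑ ys (λ y → f x y)) ≈ ∑ ys (λ y → ∑ xs (λ x → f x y))
  ∑-swap [] ys f = sym (∑-0 ys)
  ∑-swap (x ∷ xs) ys f = trans (+-congˡ (∑-swap xs ys f)) (sym (∑-+ ys (f x) (λ y → ∑ xs (λ x → f x y))))

  ∑-*ˡ : ∀ {a} {A : Set a} (k : Carrier) (xs : List A) f → k * ∑ xs f ≈ ∑ xs (λ x → k * f x)
  ∑-*ˡ k [] f = zeroʳ k
  ∑-*ˡ k (x ∷ xs) f = trans (distribˡ k _ _) (+-congˡ (∑-*ˡ k xs f))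

  ∑-*ʳ : ∀ {a} {A : Set a} (k : Carrier) (xs : List A) f → ∑ xs f * k ≈ ∑ xs (λ x → f x * k)
  ∑-*ʳ k xs f = trans (*-comm _ _) (trans (∑-*ˡ k xs f) (∑-cong xs (λ x → *-comm _ _)))

  ∑-if : ∀ {a} {A : Set a} (b : Bool) (xs : List A) f → ∑ xs (λ x → if b then 0# else f x) ≈ (if b then 0# else ∑ xs f)
  ∑-if true xs f = ∑-0 xs
  ∑-if false xs f = refl

  ∑-≡ : ∀ {a} {A : Set a} {xs ys : List A} f → xs P.≡ ys → ∑ xs f ≈ ∑ ys f
  ∑-≡ f P.refl = refl

module Splitting {c ℓ} (R : CommutativeRing c ℓ) where

  open Parking
  open FiniteSum R
  open CommutativeRing R
  open Gen R
  open import Data.Nat renaming (_+_ to _+ℕ_) using (ℕ; zero; suc; _≡ᵇ_)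
  import Data.Nat.Properties as NP
  open import Algebra.Properties.CommutativeSemigroup NP.+-commutativeSemigroup using (x∙yz≈y∙xz)
  open import Data.List using (List; []; _∷_; [_]; _++_; map)
  open import Data.Product using (_×_; _,_; proj₁; proj₂)
  open import Data.Bool using (true; false; if_then_else_; _∨_)
  import Relation.Binary.PropositionalEquality as P
  open import Relation.Binary.Reasoning.Setoid setoid

  ifFree : ℕ → (List ℕ → History → Carrier) → List ℕ → History → Carrier
  ifFree j F π h = if mem j (outcome h) then 0# else F π h

  ∑-run-∷ : ∀ N occ a π (G : History → Carrier) → ∑ (run N occ (a ∷ π)) G ≈ ∑ (step N occ a) (λ cs → ∑ (run N (proj₂ cs ∷ occ) π) (λ h → G (consHistory (proj₁ cs) (proj₂ cs) h)))
  ∑-run-∷ N occ a π G = trans (∑-concatMap (λ cs → map (consHistory (proj₁ cs) (proj₂ cs)) (run N (proj₂ cs ∷ occ) π)) (step N occ a) G)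
    (∑-cong (step N occ a) (λ cs → reflexive (∑-map (consHistory (proj₁ cs) (proj₂ cs)) (run N (proj₂ cs ∷ occ) π) G)))

  ∑-words-suc : ∀ A m (G : List ℕ → Carrier) → ∑ (words A (suc m)) G ≈ ∑ A (λ a → ∑ (words A m) (λ π → G (a ∷ π)))
  ∑-words-suc A m G = trans (∑-concatMap (λ a → map (a ∷_) (words A m)) A G) (∑-cong A (λ a → reflexive (∑-map (a ∷_) (words A m) G)))

  ∑-dropSpot : ∀ j xs (Q : Coin × ℕ → Carrier) → ∑ xs (λ cs → if j ≡ᵇ proj₂ cs then 0# else Q cs) ≈ ∑ (dropSpot j xs) Q
  ∑-dropSpot j [] Q = refl
  ∑-dropSpot j ((c , s) ∷ xs) Q with j ≡ᵇ s
  ... | true = trans (+-identityˡ _) (∑-dropSpot j xs Q)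
  ... | false = +-congˡ (∑-dropSpot j xs Q)

  if-∨ : ∀ b b' (X : Carrier) → (if (b ∨ b') then 0# else X) P.≡ (if b then 0# else (if b' then 0# else X))
  if-∨ true b' X = P.refl
  if-∨ false b' X = P.refl

  -- guardedSum sums F over the runs of m cars on [1..l+1+r] that leave spot l+1 free;
  -- interleavedSum sums it over pairs of runs on [1..l] and [1..r] and interleavings.
  guardedSum : ℕ → ℕ → ℕ → List ℕ → (List ℕ → History → Carrier) → Carrier
  guardedSum l r m occ F = ∑ (words (spots (suc l +ℕ r)) m) (λ π → ∑ (run (suc l +ℕ r) occ π) (ifFree (suc l) F π))

  afterCar : (List ℕ → History → Carrier) → ℕ → Coin × ℕ → List ℕ → History → Carrier
  afterCar F a cs π h = F (a ∷ π) (consHistory (proj₁ cs) (proj₂ cs) h)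

  firstCarSum : ℕ → ℕ → ℕ → List ℕ → (List ℕ → History → Carrier) → ℕ → Carrier
  firstCarSum l r m occ F a = ∑ (step (suc l +ℕ r) occ a) (λ cs → if suc l ≡ᵇ proj₂ cs then 0# else guardedSum l r m (proj₂ cs ∷ occ) (afterCar F a cs))

  guardedSum-suc : ∀ l r m occ F → guardedSum l r (suc m) occ F ≈ ∑ (spots (suc l +ℕ r)) (firstCarSum l r m occ F)
  guardedSum-suc l r m occ F = trans (∑-words-suc (spots N) m _) (∑-cong (spots N) λ a →
     begin
     ∑ (words (spots N) m) (λ π → ∑ (run N occ (a ∷ π)) (ifFree j F (a ∷ π)))
       ≈⟨ ∑-cong (words (spots N) m) (λ π → ∑-run-∷ N occ a π (ifFree j F (a ∷ π))) ⟩
     ∑ (words (spots N) m) (λ π → ∑ (step N occ a) (λ cs → ∑ (run N (proj₂ cs ∷ occ) π) (λ h → ifFree j F (a ∷ π) (consHistory (proj₁ cs) (proj₂ cs) h))))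
       ≈⟨ ∑-cong (words (spots N) m) (λ π → ∑-cong (step N occ a) (λ cs → ∑-cong (run N (proj₂ cs ∷ occ) π) (λ h →
            reflexive (if-∨ (j ≡ᵇ proj₂ cs) (mem j (outcome h)) (F (a ∷ π) (consHistory (proj₁ cs) (proj₂ cs) h)))))) ⟩
     ∑ (words (spots N) m) (λ π → ∑ (step N occ a) (λ cs → ∑ (run N (proj₂ cs ∷ occ) π) (λ h → if j ≡ᵇ proj₂ cs then 0# else ifFree j (afterCar F a cs) π h)))
       ≈⟨ ∑-swap (words (spots N) m) (step N occ a) _ ⟩
     ∑ (step N occ a) (λ cs → ∑ (words (spots N) m) (λ π → ∑ (run N (proj₂ cs ∷ occ) π) (λ h → if j ≡ᵇ proj₂ cs then 0# else ifFree j (afterCar F a cs) π h)))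
       ≈⟨ ∑-cong (step N occ a) (λ cs → trans (∑-cong (words (spots N) m) (λ π → ∑-if (j ≡ᵇ proj₂ cs) (run N (proj₂ cs ∷ occ) π) _))
                                         (∑-if (j ≡ᵇ proj₂ cs) (words (spots N) m) _)) ⟩
     firstCarSum l r m occ F a ∎)
    where
    N = suc l +ℕ r
    j = suc l

  pairSum : ℕ → ℕ → List ℕ → List ℕ → (List ℕ → History → Carrier) → List Side → List ℕ → List ℕ → Carrier
  pairSum l r occL occR F p πL πR = ∑ (run l occL πL) (λ hL → ∑ (run r occR πR) (λ hR → F (interleave p πL (map (suc l +ℕ_) πR)) (mergeHistory (suc l) p hL hR)))

  patternSum : ℕ → ℕ → List ℕ → List ℕ → (List ℕ → History → Carrier) → List Side → Carrier
  patternSum l r occL occR F p = ∑ (words (spots l) (lefts p)) (λ πL → ∑ (words (spots r) (rights p)) (λ πR → pairSum l r occL occR F p πL πR))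

  interleavedSum : ℕ → ℕ → ℕ → List ℕ → List ℕ → (List ℕ → History → Carrier) → Carrier
  interleavedSum l r m occL occR F = ∑ (patterns m) (patternSum l r occL occR F)

  mergeHistory-left : ∀ j p c s h h' → mergeHistory j (Lt ∷ p) (consHistory c s h) h' P.≡ consHistory c s (mergeHistory j p h h')
  mergeHistory-left j p c s (f , b , oc) (f' , b' , oc') = P.cong₂ _,_ (NP.+-assoc (fwdCount c) f f') (P.cong₂ _,_ (NP.+-assoc (bwdCount c) b b') P.refl)

  mergeHistory-right : ∀ j p c s h h' → mergeHistory j (Rt ∷ p) h (consHistory c s h') P.≡ consHistory c (j +ℕ s) (mergeHistory j p h h')
  mergeHistory-right j p c s (f , b , oc) (f' , b' , oc') = P.cong₂ _,_ (x∙yz≈y∙xz f (fwdCount c) f') (P.cong₂ _,_ (x∙yz≈y∙xz b (bwdCount c) b') P.refl)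

  interleavedSum-left : ∀ l r m occL occR F → ∑ (patterns m) (λ p → patternSum l r occL occR F (Lt ∷ p)) ≈
    ∑ (spots l) (λ a → ∑ (step l occL a) (λ cs → interleavedSum l r m (proj₂ cs ∷ occL) occR (afterCar F a cs)))
  interleavedSum-left l r m occL occR F = begin
    ∑ (patterns m) (λ p → patternSum l r occL occR F (Lt ∷ p))
      ≈⟨ ∑-cong (patterns m) (λ p → inner p) ⟩
    ∑ (patterns m) (λ p → ∑ (spots l) (λ a → ∑ (step l occL a) (λ cs → patternSum l r (proj₂ cs ∷ occL) occR (afterCar F a cs) p)))
      ≈⟨ ∑-swap (patterns m) (spots l) _ ⟩
    ∑ (spots l) (λ a → ∑ (patterns m) (λ p → ∑ (step l occL a) (λ cs → patternSum l r (proj₂ cs ∷ occL) occR (afterCar F a cs) p)))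
      ≈⟨ ∑-cong (spots l) (λ a → ∑-swap (patterns m) (step l occL a) _) ⟩
    ∑ (spots l) (λ a → ∑ (step l occL a) (λ cs → interleavedSum l r m (proj₂ cs ∷ occL) occR (afterCar F a cs))) ∎
    where
    inner : ∀ p → patternSum l r occL occR F (Lt ∷ p) ≈ ∑ (spots l) (λ a → ∑ (step l occL a) (λ cs → patternSum l r (proj₂ cs ∷ occL) occR (afterCar F a cs) p))
    inner p = trans (∑-words-suc (spots l) (lefts p) _) (∑-cong (spots l) λ a →
      begin
      ∑ (words (spots l) (lefts p)) (λ πL → ∑ (words (spots r) (rights p)) (λ πR → pairSum l r occL occR F (Lt ∷ p) (a ∷ πL) πR))
        ≈⟨ ∑-cong (words (spots l) (lefts p)) (λ πL → ∑-cong (words (spots r) (rights p)) (λ πR →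
             trans (∑-run-∷ l occL a πL _) (∑-cong (step l occL a) (λ cs → ∑-cong (run l (proj₂ cs ∷ occL) πL) (λ hL →
               ∑-cong (run r occR πR) (λ hR → reflexive (P.cong (F (a ∷ interleave p πL (map (suc l +ℕ_) πR))) (mergeHistory-left (suc l) p (proj₁ cs) (proj₂ cs) hL hR)))))))) ⟩
      ∑ (words (spots l) (lefts p)) (λ πL → ∑ (words (spots r) (rights p)) (λ πR → ∑ (step l occL a) (λ cs → pairSum l r (proj₂ cs ∷ occL) occR (afterCar F a cs) p πL πR)))
        ≈⟨ ∑-cong (words (spots l) (lefts p)) (λ πL → ∑-swap (words (spots r) (rights p)) (step l occL a) _) ⟩
      ∑ (words (spots l) (lefts p)) (λ πL → ∑ (step l occL a) (λ cs → ∑ (words (spots r) (rights p)) (λ πR → pairSum l r (proj₂ cs ∷ occL) occR (afterCar F a cs) p πL πR)))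
        ≈⟨ ∑-swap (words (spots l) (lefts p)) (step l occL a) _ ⟩
      ∑ (step l occL a) (λ cs → patternSum l r (proj₂ cs ∷ occL) occR (afterCar F a cs) p) ∎)

  afterCarShifted : (List ℕ → History → Carrier) → ℕ → ℕ → Coin × ℕ → List ℕ → History → Carrier
  afterCarShifted F j a cs = afterCar F (j +ℕ a) (proj₁ cs , j +ℕ proj₂ cs)

  interleavedSum-right : ∀ l r m occL occR F → ∑ (patterns m) (λ p → patternSum l r occL occR F (Rt ∷ p)) ≈
    ∑ (spots r) (λ a → ∑ (step r occR a) (λ cs → interleavedSum l r m occL (proj₂ cs ∷ occR) (afterCarShifted F (suc l) a cs)))
  interleavedSum-right l r m occL occR F = begin
    ∑ (patterns m) (λ p → patternSum l r occL occR F (Rt ∷ p))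
      ≈⟨ ∑-cong (patterns m) (λ p → inner p) ⟩
    ∑ (patterns m) (λ p → ∑ (spots r) (λ a → ∑ (step r occR a) (λ cs → patternSum l r occL (proj₂ cs ∷ occR) (afterCarShifted F (suc l) a cs) p)))
      ≈⟨ ∑-swap (patterns m) (spots r) _ ⟩
    ∑ (spots r) (λ a → ∑ (patterns m) (λ p → ∑ (step r occR a) (λ cs → patternSum l r occL (proj₂ cs ∷ occR) (afterCarShifted F (suc l) a cs) p)))
      ≈⟨ ∑-cong (spots r) (λ a → ∑-swap (patterns m) (step r occR a) _) ⟩
    ∑ (spots r) (λ a → ∑ (step r occR a) (λ cs → interleavedSum l r m occL (proj₂ cs ∷ occR) (afterCarShifted F (suc l) a cs))) ∎
    where
    j = suc l
    pairSum-right-∷ : ∀ p πL a πR → pairSum l r occL occR F (Rt ∷ p) πL (a ∷ πR) ≈ ∑ (step r occR a) (λ cs → pairSum l r occL (proj₂ cs ∷ occR) (afterCarShifted F j a cs) p πL πR)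
    pairSum-right-∷ p πL a πR = begin
      pairSum l r occL occR F (Rt ∷ p) πL (a ∷ πR)
        ≈⟨ ∑-cong (run l occL πL) (λ hL → trans (∑-run-∷ r occR a πR _) (∑-cong (step r occR a) (λ cs → ∑-cong (run r (proj₂ cs ∷ occR) πR) (λ hR →
             reflexive (P.cong (F ((j +ℕ a) ∷ interleave p πL (map (j +ℕ_) πR))) (mergeHistory-right j p (proj₁ cs) (proj₂ cs) hL hR)))))) ⟩
      ∑ (run l occL πL) (λ hL → ∑ (step r occR a) (λ cs → ∑ (run r (proj₂ cs ∷ occR) πR) (λ hR → afterCarShifted F j a cs (interleave p πL (map (j +ℕ_) πR)) (mergeHistory j p hL hR))))
        ≈⟨ ∑-swap (run l occL πL) (step r occR a) _ ⟩
      ∑ (step r occR a) (λ cs → pairSum l r occL (proj₂ cs ∷ occR) (afterCarShifted F j a cs) p πL πR) ∎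
    inner : ∀ p → patternSum l r occL occR F (Rt ∷ p) ≈ ∑ (spots r) (λ a → ∑ (step r occR a) (λ cs → patternSum l r occL (proj₂ cs ∷ occR) (afterCarShifted F j a cs) p))
    inner p = begin
      patternSum l r occL occR F (Rt ∷ p)
        ≈⟨ ∑-cong (words (spots l) (lefts p)) (λ πL → ∑-words-suc (spots r) (rights p) _) ⟩
      ∑ (words (spots l) (lefts p)) (λ πL → ∑ (spots r) (λ a → ∑ (words (spots r) (rights p)) (λ πR → pairSum l r occL occR F (Rt ∷ p) πL (a ∷ πR))))
        ≈⟨ ∑-cong (words (spots l) (lefts p)) (λ πL → ∑-cong (spots r) (λ a → ∑-cong (words (spots r) (rights p)) (λ πR → pairSum-right-∷ p πL a πR))) ⟩
      ∑ (words (spots l) (lefts p)) (λ πL → ∑ (spots r) (λ a → ∑ (words (spots r) (rights p)) (λ πR → ∑ (step r occR a) (λ cs → pairSum l r occL (proj₂ cs ∷ occR) (afterCarShifted F j a cs) p πL πR))))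
        ≈⟨ ∑-swap (words (spots l) (lefts p)) (spots r) _ ⟩
      ∑ (spots r) (λ a → ∑ (words (spots l) (lefts p)) (λ πL → ∑ (words (spots r) (rights p)) (λ πR → ∑ (step r occR a) (λ cs → pairSum l r occL (proj₂ cs ∷ occR) (afterCarShifted F j a cs) p πL πR))))
        ≈⟨ ∑-cong (spots r) (λ a → ∑-cong (words (spots l) (lefts p)) (λ πL → ∑-swap (words (spots r) (rights p)) (step r occR a) _)) ⟩
      ∑ (spots r) (λ a → ∑ (words (spots l) (lefts p)) (λ πL → ∑ (step r occR a) (λ cs → ∑ (words (spots r) (rights p)) (λ πR → pairSum l r occL (proj₂ cs ∷ occR) (afterCarShifted F j a cs) p πL πR))))
        ≈⟨ ∑-cong (spots r) (λ a → ∑-swap (words (spots l) (lefts p)) (step r occR a) _) ⟩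
      ∑ (spots r) (λ a → ∑ (step r occR a) (λ cs → patternSum l r occL (proj₂ cs ∷ occR) (afterCarShifted F j a cs) p)) ∎

  splitAtFreeSpot : ∀ l r m occ occL occR F → Splits l r occ occL occR → guardedSum l r m occ F ≈ interleavedSum l r m occL occR F
  splitAtFreeSpot l r zero occ occL occR F rel = trans (+-identityʳ _) (trans (+-identityʳ _)
    (sym (trans (+-identityʳ _) (trans (+-identityʳ _) (trans (+-identityʳ _) (trans (+-identityʳ _) (+-identityʳ _)))))))
  splitAtFreeSpot l r (suc m) occ occL occR F rel@(h1 , h2 , h3) = begin
    guardedSum l r (suc m) occ F ≈⟨ guardedSum-suc l r m occ F ⟩
    ∑ (spots N) (firstCarSum l r m occ F) ≈⟨ ∑-≡ (firstCarSum l r m occ F) (spots-split l r) ⟩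
    ∑ (spots l ++ j ∷ map (j +ℕ_) (spots r)) (firstCarSum l r m occ F) ≈⟨ ∑-++ (spots l) (j ∷ map (j +ℕ_) (spots r)) _ ⟩
    ∑ (spots l) (firstCarSum l r m occ F) + (firstCarSum l r m occ F j + ∑ (map (j +ℕ_) (spots r)) (firstCarSum l r m occ F))
      ≈⟨ +-cong firstCarLeft (+-cong firstCarAtFreeSpot (trans (reflexive (∑-map (j +ℕ_) (spots r) (firstCarSum l r m occ F))) firstCarRight)) ⟩
    ∑ (spots l) (λ a → ∑ (step l occL a) (λ cs → interleavedSum l r m (proj₂ cs ∷ occL) occR (afterCar F a cs)))
      + (0# + ∑ (spots r) (λ a → ∑ (step r occR a) (λ cs → interleavedSum l r m occL (proj₂ cs ∷ occR) (afterCarShifted F (suc l) a cs))))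
      ≈⟨ +-cong (sym (interleavedSum-left l r m occL occR F)) (trans (+-identityˡ _) (sym (interleavedSum-right l r m occL occR F))) ⟩
    ∑ (patterns m) (λ p → patternSum l r occL occR F (Lt ∷ p)) + ∑ (patterns m) (λ p → patternSum l r occL occR F (Rt ∷ p))
      ≈⟨ sym (+-cong (reflexive (∑-map (Lt ∷_) (patterns m) (patternSum l r occL occR F))) (reflexive (∑-map (Rt ∷_) (patterns m) (patternSum l r occL occR F)))) ⟩
    ∑ (map (Lt ∷_) (patterns m)) (patternSum l r occL occR F) + ∑ (map (Rt ∷_) (patterns m)) (patternSum l r occL occR F)
      ≈⟨ sym (∑-++ (map (Lt ∷_) (patterns m)) (map (Rt ∷_) (patterns m)) _) ⟩
    interleavedSum l r (suc m) occL occR F ∎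
    where
    N = suc l +ℕ r
    j = suc l
    firstCarAtFreeSpot : firstCarSum l r m occ F j ≈ 0#
    firstCarAtFreeSpot rewrite step-free N occ j h2 | ≡ᵇ-refl l = +-identityʳ _
    firstCarLeft : ∑ (spots l) (firstCarSum l r m occ F) ≈ ∑ (spots l) (λ a → ∑ (step l occL a) (λ cs → interleavedSum l r m (proj₂ cs ∷ occL) occR (afterCar F a cs)))
    firstCarLeft = ∑-cong-All (spots l) (All-spots l) λ a pa → begin
      firstCarSum l r m occ F a ≈⟨ ∑-dropSpot j (step N occ a) _ ⟩
      ∑ (dropSpot j (step N occ a)) (λ cs → guardedSum l r m (proj₂ cs ∷ occ) (afterCar F a cs)) ≈⟨ ∑-≡ _ (step-left l r occ occL occR a pa rel) ⟩
      ∑ (step l occL a) (λ cs → guardedSum l r m (proj₂ cs ∷ occ) (afterCar F a cs))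
        ≈⟨ ∑-cong-All (step l occL a) (step-landsFree l occL a pa) (λ cs ok → splitAtFreeSpot l r m (proj₂ cs ∷ occ) (proj₂ cs ∷ occL) occR (afterCar F a cs) (Splits-∷ˡ l r {occ} {occL} {occR} (proj₂ cs) (proj₂ ok) rel)) ⟩
      ∑ (step l occL a) (λ cs → interleavedSum l r m (proj₂ cs ∷ occL) occR (afterCar F a cs)) ∎
    firstCarRight : ∑ (spots r) (λ a → firstCarSum l r m occ F (j +ℕ a)) ≈ ∑ (spots r) (λ a → ∑ (step r occR a) (λ cs → interleavedSum l r m occL (proj₂ cs ∷ occR) (afterCarShifted F (suc l) a cs)))
    firstCarRight = ∑-cong-All (spots r) (All-spots r) λ a pa → begin
      firstCarSum l r m occ F (j +ℕ a) ≈⟨ ∑-dropSpot j (step N occ (j +ℕ a)) _ ⟩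
      ∑ (dropSpot j (step N occ (j +ℕ a))) (λ cs → guardedSum l r m (proj₂ cs ∷ occ) (afterCar F (j +ℕ a) cs)) ≈⟨ ∑-≡ _ (step-right l r occ occL occR a pa rel) ⟩
      ∑ (map (shiftSpot j) (step r occR a)) (λ cs → guardedSum l r m (proj₂ cs ∷ occ) (afterCar F (j +ℕ a) cs)) ≈⟨ reflexive (∑-map (shiftSpot j) (step r occR a) _) ⟩
      ∑ (step r occR a) (λ cs → guardedSum l r m ((j +ℕ proj₂ cs) ∷ occ) (afterCarShifted F j a cs))
        ≈⟨ ∑-cong-All (step r occR a) (step-landsFree r occR a pa) (λ cs ok → splitAtFreeSpot l r m ((j +ℕ proj₂ cs) ∷ occ) occL (proj₂ cs ∷ occR) (afterCarShifted F j a cs) (Splits-∷ʳ l r {occ} {occL} {occR} (proj₂ cs) (proj₂ ok) rel)) ⟩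
      ∑ (step r occR a) (λ cs → interleavedSum l r m occL (proj₂ cs ∷ occR) (afterCarShifted F (suc l) a cs)) ∎

module Recurrence {c ℓ} (R : CommutativeRing c ℓ) where

  open Parking
  open FiniteSum R
  open Splitting R
  open CommutativeRing R hiding (zero)
  open Gen R
  open import Data.Nat renaming (_+_ to _+ℕ_) using (ℕ; zero; suc; _∸_; _≤_; _<_; z≤n; s≤s; _≡ᵇ_)
  import Data.Nat.Properties as NP
  open import Algebra.Properties.CommutativeSemigroup NP.+-commutativeSemigroup using (x∙yz≈y∙xz)
  open import Data.Nat.Combinatorics using (_C_; nCk+nC[k+1]≡[n+1]C[k+1]; nCn≡1)
  open import Data.List using (List; []; _∷_; [_]; _++_; map; concatMap; upTo; applyUpTo; length; reverse; _ʳ++_)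
  open import Data.List.Properties using (map-upTo; upTo-∷ʳ)
  open import Data.List.Relation.Unary.All using (All; []; _∷_)
  import Data.List.Relation.Unary.All as All
  open import Data.List.Relation.Unary.All.Properties using (++⁺; concat⁺; map⁺; all-upTo)
  open import Data.Product using (_×_; _,_; proj₁; proj₂)
  open import Data.Bool using (true; false; if_then_else_)
  open import Data.Empty using (⊥-elim)
  import Relation.Binary.PropositionalEquality as P
  open import Relation.Binary.Reasoning.Setoid setoid
  open import Relation.Binary.Definitions using (tri<; tri≈; tri>)
  open import Algebra.Solver.Ring.NaturalCoefficients.Default commutativeSemiring

  pow-+ : ∀ u m n → pow u (m +ℕ n) ≈ pow u m * pow u n
  pow-+ u zero n = sym (*-identityˡ _)
  pow-+ u (suc m) n = trans (*-congˡ (pow-+ u m n)) (sym (*-assoc _ _ _))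

  pow-1# : ∀ n → pow 1# n ≈ 1#
  pow-1# zero = refl
  pow-1# (suc n) = trans (*-identityˡ _) (pow-1# n)

  nat-+ : ∀ a b → nat (a +ℕ b) ≈ nat a + nat b
  nat-+ zero b = sym (+-identityˡ _)
  nat-+ (suc a) b = trans (+-congˡ (nat-+ a b)) (sym (+-assoc _ _ _))

  nat-1-* : ∀ V → nat 1 * V ≈ V
  nat-1-* V = trans (*-congʳ (+-identityʳ 1#)) (*-identityˡ V)

  ∑-if-mem : ∀ ks X V → ∑ ks (λ k → if mem k X then 0# else V) ≈ nat (countNotMem ks X) * V
  ∑-if-mem [] X V = sym (zeroˡ V)
  ∑-if-mem (k ∷ ks) X V with mem k X
  ... | true = trans (+-identityˡ _) (∑-if-mem ks X V)
  ... | false = trans (+-cong (sym (*-identityˡ V)) (∑-if-mem ks X V)) (sym (distribʳ V 1# _))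

  prefs-words : ∀ N m → prefs N m P.≡ words (spots N) m
  prefs-words N zero = P.refl
  prefs-words N (suc m) rewrite prefs-words N m | map-upTo suc N = P.refl

  sumR≡∑ : ∀ (xs : List Carrier) → sumR xs P.≡ ∑ xs (λ u → u)
  sumR≡∑ [] = P.refl
  sumR≡∑ (u ∷ xs) = P.cong (u +_) (sumR≡∑ xs)

  P'≈∑ : ∀ p N x y z w → P' p N x y z w ≈ ∑ (words (spots N) N) (λ π → ∑ (run N [] π) (weight p N x y z w π))
  P'≈∑ p N x y z w = begin
    P' p N x y z w ≡⟨ sumR≡∑ (concatMap g (prefs N N)) ⟩
    ∑ (concatMap g (prefs N N)) (λ u → u) ≈⟨ ∑-concatMap g (prefs N N) _ ⟩
    ∑ (prefs N N) (λ π → ∑ (map (weight p N x y z w π) (run N [] π)) (λ u → u)) ≡⟨ P.cong₂ ∑ (prefs-words N N) P.refl ⟩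
    ∑ (words (spots N) N) (λ π → ∑ (map (weight p N x y z w π) (run N [] π)) (λ u → u)) ≈⟨ ∑-cong (words (spots N) N) (λ π → reflexive (∑-map _ (run N [] π) _)) ⟩
    ∑ (words (spots N) N) (λ π → ∑ (run N [] π) (weight p N x y z w π)) ∎
    where g = λ π → map (weight p N x y z w π) (run N [] π)

  ∑-words-∷ʳ : ∀ A m (G : List ℕ → Carrier) → ∑ (words A (suc m)) G ≈ ∑ (words A m) (λ π → ∑ A (λ a → G (π ++ [ a ])))
  ∑-words-∷ʳ A zero G = trans (∑-words-suc A zero G) (trans (∑-cong A (λ a → +-identityʳ _)) (sym (+-identityʳ _)))
  ∑-words-∷ʳ A (suc m) G = begin
    ∑ (words A (suc (suc m))) G ≈⟨ ∑-words-suc A (suc m) G ⟩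
    ∑ A (λ a → ∑ (words A (suc m)) (λ π → G (a ∷ π))) ≈⟨ ∑-cong A (λ a → ∑-words-∷ʳ A m (λ π → G (a ∷ π))) ⟩
    ∑ A (λ a → ∑ (words A m) (λ π → ∑ A (λ b → G (a ∷ π ++ [ b ])))) ≈⟨ sym (∑-words-suc A m _) ⟩
    ∑ (words A (suc m)) (λ π → ∑ A (λ a → G (π ++ [ a ]))) ∎

  snocHistory : History → Coin × ℕ → History
  snocHistory (f , b , oc) (c , s) = (fwdCount c +ℕ f , bwdCount c +ℕ b , oc ++ [ s ])

  ∑-run-∷ʳ : ∀ N occ π a (G : History → Carrier) → ∑ (run N occ (π ++ [ a ])) G ≈ ∑ (run N occ π) (λ h → ∑ (step N (outcome h ʳ++ occ) a) (λ cs → G (snocHistory h cs)))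
  ∑-run-∷ʳ N occ [] a G = trans (∑-run-∷ N occ a [] G) (trans (∑-cong (step N occ a) (λ cs → +-identityʳ _)) (sym (+-identityʳ _)))
  ∑-run-∷ʳ N occ (a' ∷ π) a G = begin
    ∑ (run N occ (a' ∷ π ++ [ a ])) G ≈⟨ ∑-run-∷ N occ a' (π ++ [ a ]) G ⟩
    ∑ (step N occ a') (λ cs' → ∑ (run N (proj₂ cs' ∷ occ) (π ++ [ a ])) (λ h → G (consHistory (proj₁ cs') (proj₂ cs') h)))
      ≈⟨ ∑-cong (step N occ a') (λ cs' → trans (∑-run-∷ʳ N (proj₂ cs' ∷ occ) π a _) (∑-cong (run N (proj₂ cs' ∷ occ) π) (λ h →
            ∑-cong (step N (outcome h ʳ++ (proj₂ cs' ∷ occ)) a) (λ cs → reflexive (P.cong G (eqh (proj₁ cs') (proj₂ cs') h cs)))))) ⟩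
    ∑ (step N occ a') (λ cs' → ∑ (run N (proj₂ cs' ∷ occ) π) (λ h → ∑ (step N (outcome h ʳ++ (proj₂ cs' ∷ occ)) a) (λ cs → G (snocHistory (consHistory (proj₁ cs') (proj₂ cs') h) cs))))
      ≈⟨ sym (∑-run-∷ N occ a' π _) ⟩
    ∑ (run N occ (a' ∷ π)) (λ h → ∑ (step N (outcome h ʳ++ occ) a) (λ cs → G (snocHistory h cs))) ∎
    where
    eqh : ∀ c' s' h cs → consHistory c' s' (snocHistory h cs) P.≡ snocHistory (consHistory c' s' h) cs
    eqh c' s' (f , b , oc) (c , s) = P.cong₂ _,_ (x∙yz≈y∙xz (fwdCount c') (fwdCount c) f) (P.cong₂ _,_ (x∙yz≈y∙xz (bwdCount c') (bwdCount c) b) P.refl)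

  Word : ℕ → ℕ → List ℕ → Set
  Word N m π = All (Spot N) π × length π P.≡ m

  words-valid : ∀ N m → All (Word N m) (words (spots N) m)
  words-valid N zero = ([] , P.refl) ∷ []
  words-valid N (suc m) = concat⁺ (map⁺ (All.map (λ {a} pa → map⁺ (All.map (λ {π} ok → (pa ∷ proj₁ ok) , P.cong suc (proj₂ ok)) (words-valid N m))) (All-spots N)))

  ∑-patterns-lefts : ∀ n l (K : Carrier) → ∑ (patterns n) (λ pt → if lefts pt ≡ᵇ l then K else 0#) ≈ nat (n C l) * K
  ∑-patterns-lefts zero zero K = trans (+-identityʳ K) (sym (nat-1-* K))
  ∑-patterns-lefts zero (suc l) K = trans (+-identityʳ _) (sym (zeroˡ K))
  ∑-patterns-lefts (suc n) l K = begin
    ∑ (map (Lt ∷_) (patterns n) ++ map (Rt ∷_) (patterns n)) G ≈⟨ ∑-++ (map (Lt ∷_) (patterns n)) (map (Rt ∷_) (patterns n)) G ⟩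
    ∑ (map (Lt ∷_) (patterns n)) G + ∑ (map (Rt ∷_) (patterns n)) G ≈⟨ +-cong (reflexive (∑-map (Lt ∷_) (patterns n) G)) (reflexive (∑-map (Rt ∷_) (patterns n) G)) ⟩
    ∑ (patterns n) (λ pt → if suc (lefts pt) ≡ᵇ l then K else 0#) + ∑ (patterns n) (λ pt → if lefts pt ≡ᵇ l then K else 0#) ≈⟨ +-congˡ (∑-patterns-lefts n l K) ⟩
    ∑ (patterns n) (λ pt → if suc (lefts pt) ≡ᵇ l then K else 0#) + nat (n C l) * K ≈⟨ lem l ⟩
    nat (suc n C l) * K ∎
    where
    G = λ pt → if lefts pt ≡ᵇ l then K else 0#
    lem : ∀ l → ∑ (patterns n) (λ pt → if suc (lefts pt) ≡ᵇ l then K else 0#) + nat (n C l) * K ≈ nat (suc n C l) * K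
    lem zero = trans (+-congʳ (∑-0 (patterns n))) (+-identityˡ _)
    lem (suc l) = begin
      ∑ (patterns n) (λ pt → if lefts pt ≡ᵇ l then K else 0#) + nat (n C suc l) * K ≈⟨ +-congʳ (∑-patterns-lefts n l K) ⟩
      nat (n C l) * K + nat (n C suc l) * K ≈⟨ sym (distribʳ K _ _) ⟩
      (nat (n C l) + nat (n C suc l)) * K ≈⟨ *-congʳ (sym (nat-+ (n C l) (n C suc l))) ⟩
      nat (n C l +ℕ n C suc l) * K ≡⟨ P.cong (λ u → nat u * K) (nCk+nC[k+1]≡[n+1]C[k+1] n l) ⟩
      nat (suc n C suc l) * K ∎

  patterns-length : ∀ n → All (λ pt → lefts pt +ℕ rights pt P.≡ n) (patterns n)
  patterns-length zero = P.refl ∷ []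
  patterns-length (suc n) = ++⁺ (map⁺ (All.map (λ {pt} e → P.cong suc e) (patterns-length n)))
                        (map⁺ (All.map (λ {pt} e → P.trans (NP.+-suc (lefts pt) (rights pt)) (P.cong suc e)) (patterns-length n)))

  ∑∑-* : ∀ {a b} {A : Set a} {B : Set b} (xs : List A) (ys : List B) f g K → ∑ xs (λ u → ∑ ys (λ v → f u * g v * K)) ≈ ∑ xs f * ∑ ys g * K
  ∑∑-* xs ys f g K = begin
    ∑ xs (λ u → ∑ ys (λ v → f u * g v * K)) ≈⟨ ∑-cong xs (λ u → trans (sym (∑-*ʳ K ys (λ v → f u * g v))) (*-congʳ (sym (∑-*ˡ (f u) ys g)))) ⟩
    ∑ xs (λ u → f u * ∑ ys g * K) ≈⟨ sym (∑-*ʳ K xs (λ u → f u * ∑ ys g)) ⟩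
    ∑ xs (λ u → f u * ∑ ys g) * K ≈⟨ *-congʳ (sym (∑-*ʳ (∑ ys g) xs f)) ⟩
    ∑ xs f * ∑ ys g * K ∎

  ∑-run-zero : ∀ N occ π (F : History → Carrier) → All (Spot N) π → (∀ h → ValidHistory N occ π h → F h ≈ 0#) → ∑ (run N occ π) F ≈ 0#
  ∑-run-zero N occ π F pπ hF = trans (∑-cong-All (run N occ π) (run-valid N occ π pπ) hF) (∑-0 (run N occ π))

  ∑-run-overfull : ∀ N π (F : History → Carrier) → All (Spot N) π → N < length π → ∑ (run N [] π) F ≈ 0#
  ∑-run-overfull N π F pπ N<len = ∑-run-zero N [] π F pπ (λ h (fresh , len) →
    ⊥-elim (NP.<⇒≱ N<len (P.subst (_≤ N) len (fresh-length≤ N (outcome h) fresh))))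

  patternSum-vanishes : ∀ l r pt F → (∀ πL πR → Word l (lefts pt) πL → Word r (rights pt) πR → pairSum l r [] [] F pt πL πR ≈ 0#) →
    patternSum l r [] [] F pt ≈ 0#
  patternSum-vanishes l r pt F h =
    trans (∑-cong-All _ (words-valid l (lefts pt)) (λ πL okL →
      trans (∑-cong-All _ (words-valid r (rights pt)) (λ πR okR → h πL πR okL okR)) (∑-0 (words (spots r) (rights pt)))))
      (∑-0 (words (spots l) (lefts pt)))

  ∑-spots : ∀ n (F : ℕ → Carrier) → ∑ (spots n) F ≈ ∑ (upTo n) (λ k → F (suc k))
  ∑-spots n F = trans (∑-≡ F (P.sym (map-upTo suc n))) (reflexive (∑-map suc (upTo n) F))

  ∑-upTo-reverse : ∀ l (g : ℕ → Carrier) → ∑ (upTo l) (λ k → g (l ∸ k)) ≈ ∑ (upTo l) (λ k → g (suc k))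
  ∑-upTo-reverse zero g = refl
  ∑-upTo-reverse (suc l) g = begin
    g (suc l) + ∑ (applyUpTo suc l) (λ k → g (suc l ∸ k)) ≈⟨ +-congˡ (∑-spots l (λ k → g (suc l ∸ k))) ⟩
    g (suc l) + ∑ (upTo l) (λ k → g (l ∸ k)) ≈⟨ +-congˡ (∑-upTo-reverse l g) ⟩
    g (suc l) + ∑ (upTo l) (λ k → g (suc k)) ≈⟨ +-comm _ _ ⟩
    ∑ (upTo l) (λ k → g (suc k)) + g (suc l) ≈⟨ +-congˡ (sym (+-identityʳ _)) ⟩
    ∑ (upTo l) (λ k → g (suc k)) + (g (suc l) + 0#) ≈⟨ sym (∑-++ (upTo l) [ l ] _) ⟩
    ∑ (upTo l ++ [ l ]) (λ k → g (suc k)) ≡⟨ P.cong (λ u → ∑ u (λ k → g (suc k))) (upTo-∷ʳ l) ⟩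
    ∑ (upTo (suc l)) (λ k → g (suc k)) ∎

  module Terms (p x y z : Carrier) where
    q = 1# + - p

    -- The weight of the first n cars, except that des and rlm are already taken of the
    -- outcome in which the last car parks on spot l+1.
    prefixWeight : ℕ → ℕ → Carrier → List ℕ → History → Carrier
    prefixWeight l r w π (f , b , oc) = pow p f * pow q b * pow x (unl oc π) * pow y (dis oc π)
      * pow z (des (inv (suc l +ℕ r) (oc ++ [ suc l ]))) * pow w (rlm (inv (suc l +ℕ r) (oc ++ [ suc l ])))

    lastCarWeight : ℕ → ℕ → Coin → Carrier
    lastCarWeight l a c = pow p (fwdCount c) * pow q (bwdCount c) * pow x (unl [ suc l ] [ a ]) * pow y (dis [ suc l ] [ a ])

    weight-∷ʳ : ∀ l r w π f b oc a c → length oc P.≡ length π →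
      weight p (suc l +ℕ r) x y z w (π ++ [ a ]) (snocHistory (f , b , oc) (c , suc l)) ≈ lastCarWeight l a c * prefixWeight l r w π (f , b , oc)
    weight-∷ʳ l r w π f b oc a c e = begin
      pow p (fwdCount c +ℕ f) * pow q (bwdCount c +ℕ b) * pow x (unl (oc ++ [ j ]) (π ++ [ a ])) * pow y (dis (oc ++ [ j ]) (π ++ [ a ])) * Zd * Wd
        ≈⟨ *-congʳ (*-congʳ (*-cong (*-cong (*-cong (pow-+ p (fwdCount c) f) (pow-+ q (bwdCount c) b))
              (trans (reflexive (P.cong (pow x) (unl-∷ʳ oc π j a e))) (pow-+ x (unl oc π) (unl [ j ] [ a ]))))
              (trans (reflexive (P.cong (pow y) (dis-∷ʳ oc π j a e))) (pow-+ y (dis oc π) (dis [ j ] [ a ]))))) ⟩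
      (P1 * P2) * (Q1 * Q2) * (X1 * X2) * (Y1 * Y2) * Zd * Wd
        ≈⟨ solve 10 (λ P1 P2 Q1 Q2 X1 X2 Y1 Y2 Zd Wd → (P1 :* P2) :* (Q1 :* Q2) :* (X1 :* X2) :* (Y1 :* Y2) :* Zd :* Wd
              := (P1 :* Q1 :* X2 :* Y2) :* (P2 :* Q2 :* X1 :* Y1 :* Zd :* Wd)) refl P1 P2 Q1 Q2 X1 X2 Y1 Y2 Zd Wd ⟩
      lastCarWeight l a c * prefixWeight l r w π (f , b , oc) ∎
      where
      j = suc l
      P1 = pow p (fwdCount c)
      P2 = pow p f
      Q1 = pow q (bwdCount c)
      Q2 = pow q b
      X1 = pow x (unl oc π)
      X2 = pow x (unl [ j ] [ a ])
      Y1 = pow y (dis oc π)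
      Y2 = pow y (dis [ j ] [ a ])
      Zd = pow z (des (inv (suc l +ℕ r) (oc ++ [ j ])))
      Wd = pow w (rlm (inv (suc l +ℕ r) (oc ++ [ j ])))

    lastCarSum : ℕ → Carrier → List ℕ → History → Carrier
    lastCarSum N w π h = ∑ (spots N) (λ a → ∑ (step N (reverse (outcome h)) a) (λ cs → weight p N x y z w (π ++ [ a ]) (snocHistory h cs)))

    lastCarFactor : ℕ → ℕ → Carrier
    lastCarFactor l r = ∑ (spots l) (λ a → lastCarWeight l a fwd) + (lastCarWeight l (suc l) stay + ∑ (spots r) (λ a → lastCarWeight l (suc l +ℕ a) bwd))

    lastCarSum-factor : ∀ l r w π f b oc → Fresh (suc l +ℕ r) [] oc → length oc P.≡ l +ℕ r → length π P.≡ l +ℕ r → mem (suc l) oc P.≡ false →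
      lastCarSum (suc l +ℕ r) w π (f , b , oc) ≈ lastCarFactor l r * prefixWeight l r w π (f , b , oc)
    lastCarSum-factor l r w π f b oc Fr lo lπ mj = begin
      lastCarSum (suc l +ℕ r) w π h ≈⟨ ∑-≡ lastCar (spots-split l r) ⟩
      ∑ (spots l ++ j ∷ map (j +ℕ_) (spots r)) lastCar ≈⟨ ∑-++ (spots l) (j ∷ map (j +ℕ_) (spots r)) lastCar ⟩
      ∑ (spots l) lastCar + (lastCar j + ∑ (map (j +ℕ_) (spots r)) lastCar) ≈⟨ +-cong lastCarLeft (+-cong lastCarAtFreeSpot (trans (reflexive (∑-map (j +ℕ_) (spots r) lastCar)) lastCarRight)) ⟩
      ∑ (spots l) (λ a → lastCarWeight l a fwd) * prefix + (lastCarWeight l j stay * prefix + ∑ (spots r) (λ a → lastCarWeight l (j +ℕ a) bwd) * prefix)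
        ≈⟨ trans (+-congˡ (sym (distribʳ prefix _ _))) (sym (distribʳ prefix _ _)) ⟩
      lastCarFactor l r * prefix ∎
      where
      j = suc l
      N = suc l +ℕ r
      h = (f , b , oc)
      X = reverse oc
      prefix = prefixWeight l r w π h
      lastCar = λ a → ∑ (step N X a) (λ cs → weight p N x y z w (π ++ [ a ]) (snocHistory h cs))
      occupied = otherSpotsOccupied l r oc Fr lo mj
      h1 : ∀ k → Spot l k → mem k X P.≡ true
      h1 k pk = P.trans (mem-reverse k oc) (proj₁ occupied k pk)
      h2 : mem j X P.≡ false
      h2 = P.trans (mem-reverse j oc) mj
      h3 : ∀ k → Spot r k → mem (j +ℕ k) X P.≡ true
      h3 k pk = P.trans (mem-reverse (j +ℕ k) oc) (proj₂ occupied k pk)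
      open LastCar l r X h1 h2 h3
      length-oc≡π = P.trans lo (P.sym lπ)
      lastCarLeft : ∑ (spots l) lastCar ≈ ∑ (spots l) (λ a → lastCarWeight l a fwd) * prefix
      lastCarLeft = trans (∑-cong-All (spots l) (All-spots l) (λ a pa → trans (∑-≡ _ (step-last-left a pa)) (trans (+-identityʳ _) (weight-∷ʳ l r w π f b oc a fwd length-oc≡π))))
                (sym (∑-*ʳ prefix (spots l) _))
      lastCarAtFreeSpot : lastCar j ≈ lastCarWeight l j stay * prefix
      lastCarAtFreeSpot = trans (∑-≡ _ step-last-free) (trans (+-identityʳ _) (weight-∷ʳ l r w π f b oc j stay length-oc≡π))
      lastCarRight : ∑ (spots r) (λ a → lastCar (j +ℕ a)) ≈ ∑ (spots r) (λ a → lastCarWeight l (j +ℕ a) bwd) * prefix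
      lastCarRight = trans (∑-cong-All (spots r) (All-spots r) (λ a pa → trans (∑-≡ _ (step-last-right a pa)) (trans (+-identityʳ _) (weight-∷ʳ l r w π f b oc (j +ℕ a) bwd length-oc≡π))))
                (sym (∑-*ʳ prefix (spots r) _))

    xyGeom≡∑ : ∀ n → xyGeom x y n P.≡ ∑ (upTo n) (λ k → x * pow y (suc k))
    xyGeom≡∑ n = sumR-map≡∑ (upTo n) _

    lastCarFactor-closed : ∀ l r → lastCarFactor l r ≈ 1# + p * xyGeom x y l + q * xyGeom x y r
    lastCarFactor-closed l r = begin
      lastCarFactor l r ≈⟨ +-cong forwardPart (+-cong stayPart backwardPart) ⟩
      p * xyGeom x y l + (1# + q * xyGeom x y r) ≈⟨ solve 3 (λ u v w → u :+ (con 1 :+ w) := con 1 :+ u :+ w) refl (p * xyGeom x y l) 1# (q * xyGeom x y r) ⟩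
      1# + p * xyGeom x y l + q * xyGeom x y r ∎
      where
      forwardPart : ∑ (spots l) (λ a → lastCarWeight l a fwd) ≈ p * xyGeom x y l
      forwardPart = begin
        ∑ (spots l) (λ a → lastCarWeight l a fwd) ≈⟨ ∑-spots l _ ⟩
        ∑ (upTo l) (λ k → lastCarWeight l (suc k) fwd) ≈⟨ ∑-cong-All (upTo l) (all-upTo l) (λ k k<l → lastCarWeight-term k k<l) ⟩
        ∑ (upTo l) (λ k → p * (x * pow y (l ∸ k))) ≈⟨ sym (∑-*ˡ p (upTo l) _) ⟩
        p * ∑ (upTo l) (λ k → x * pow y (l ∸ k)) ≈⟨ *-congˡ (∑-upTo-reverse l (λ m → x * pow y m)) ⟩
        p * ∑ (upTo l) (λ k → x * pow y (suc k)) ≡⟨ P.cong (p *_) (P.sym (xyGeom≡∑ l)) ⟩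
        p * xyGeom x y l ∎
        where
        lastCarWeight-term : ∀ k → k < l → lastCarWeight l (suc k) fwd ≈ p * (x * pow y (l ∸ k))
        lastCarWeight-term k k<l rewrite >⇒≡ᵇ-false k<l | NP.m≤n⇒∣n-m∣≡n∸m (NP.<⇒≤ k<l) | NP.+-identityʳ (l ∸ k) =
          solve 3 (λ P X Y → P :* con 1 :* con 1 :* (X :* con 1) :* Y := P :* (X :* Y)) refl p x (pow y (l ∸ k))
      stayPart : lastCarWeight l (suc l) stay ≈ 1#
      stayPart rewrite ≡ᵇ-refl l | NP.∣n-n∣≡0 l = solve 0 (con 1 :* con 1 :* con 1 :* con 1 := con 1) refl
      backwardPart : ∑ (spots r) (λ a → lastCarWeight l (suc l +ℕ a) bwd) ≈ q * xyGeom x y r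
      backwardPart = begin
        ∑ (spots r) (λ a → lastCarWeight l (suc l +ℕ a) bwd) ≈⟨ ∑-spots r _ ⟩
        ∑ (upTo r) (λ k → lastCarWeight l (suc l +ℕ suc k) bwd) ≈⟨ ∑-cong (upTo r) lastCarWeight-term ⟩
        ∑ (upTo r) (λ k → q * (x * pow y (suc k))) ≈⟨ sym (∑-*ˡ q (upTo r) _) ⟩
        q * ∑ (upTo r) (λ k → x * pow y (suc k)) ≡⟨ P.cong (q *_) (P.sym (xyGeom≡∑ r)) ⟩
        q * xyGeom x y r ∎
        where
        lastCarWeight-term : ∀ k → lastCarWeight l (suc l +ℕ suc k) bwd ≈ q * (x * pow y (suc k))
        lastCarWeight-term k rewrite <⇒≡ᵇ-false (NP.m<m+n (suc l) {suc k} (s≤s z≤n)) | NP.∣m-m+n∣≡n (suc l) (suc k) | NP.+-identityʳ k =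
          solve 4 (λ Q X Y1 YK → con 1 :* (Q :* con 1) :* (X :* con 1) :* (Y1 :* YK) := Q :* (X :* (Y1 :* YK))) refl q x y (pow y k)

    prefixWeight-interleave : ∀ l r w pt πL πR fL bL ocL fR bR ocR → lefts pt P.≡ l → rights pt P.≡ r →
      Fresh l [] ocL → length ocL P.≡ l → length πL P.≡ l → Fresh r [] ocR → length ocR P.≡ r → length πR P.≡ r →
      prefixWeight l r w (interleave pt πL (map (suc l +ℕ_) πR)) (mergeHistory (suc l) pt (fL , bL , ocL) (fR , bR , ocR))
        ≈ weight p l x y z 1# πL (fL , bL , ocL) * weight p r x y z w πR (fR , bR , ocR) * (pow z (sgn r) * w)
    prefixWeight-interleave l r w pt πL πR fL bL ocL fR bR ocR eL eR FL lL lπL FR lR lπR = begin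
      pow p (fL +ℕ fR) * pow q (bL +ℕ bR) * pow x (unl M Mπ) * pow y (dis M Mπ) * pow z (des (inv N (M ++ [ j ]))) * pow w (rlm (inv N (M ++ [ j ])))
        ≈⟨ *-cong (*-cong (*-cong (*-cong (*-cong (pow-+ p fL fR) (pow-+ q bL bR))
               (trans (reflexive (P.cong (pow x) unl-split)) (pow-+ x (unl ocL πL) (unl ocR πR))))
               (trans (reflexive (P.cong (pow y) dis-split)) (pow-+ y (dis ocL πL) (dis ocR πR))))
               (trans (reflexive (P.cong (pow z) Inv.des-inv-interleaving)) (trans (pow-+ z (des (inv l ocL) +ℕ sgn r) (des (inv r ocR))) (*-congʳ (pow-+ z (des (inv l ocL)) (sgn r))))))
               (reflexive (P.cong (pow w) Inv.rlm-inv-interleaving)) ⟩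
      (PL * PR) * (QL * QR) * (XL * XR) * (YL * YR) * ((ZL * Zr) * ZR) * (w * rightWeight)
        ≈⟨ solve 13 (λ PL PR QL QR XL XR YL YR ZL Zr ZR W rightWeight →
              (PL :* PR) :* (QL :* QR) :* (XL :* XR) :* (YL :* YR) :* ((ZL :* Zr) :* ZR) :* (W :* rightWeight)
              := (PL :* QL :* XL :* YL :* ZL :* con 1) :* (PR :* QR :* XR :* YR :* ZR :* rightWeight) :* (Zr :* W)) refl
              PL PR QL QR XL XR YL YR ZL Zr ZR w rightWeight ⟩
      (PL * QL * XL * YL * ZL * 1#) * (PR * QR * XR * YR * ZR * rightWeight) * (Zr * w)
        ≈⟨ *-congʳ (*-congʳ (*-congˡ (sym (pow-1# (rlm (inv l ocL)))))) ⟩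
      weight p l x y z 1# πL (fL , bL , ocL) * weight p r x y z w πR (fR , bR , ocR) * (pow z (sgn r) * w) ∎
      where
      j = suc l
      N = suc l +ℕ r
      M = interleave pt ocL (map (j +ℕ_) ocR)
      Mπ = interleave pt πL (map (j +ℕ_) πR)
      module Inv = InverseOfInterleaving l r pt ocL ocR eL eR FL lL FR lR
      lenOcL = P.trans lL (P.sym eL)
      lenπL = P.trans lπL (P.sym eL)
      lenOcR = P.trans lR (P.sym eR)
      lenπR = P.trans lπR (P.sym eR)
      unl-split : unl M Mπ P.≡ unl ocL πL +ℕ unl ocR πR
      unl-split = P.trans (unl≡zipSum M Mπ) (P.trans (zipSum-interleave-shift _ l pt ocL ocR πL πR (mismatch-shift j) lenOcL lenπL lenOcR lenπR)
             (P.sym (P.cong₂ _+ℕ_ (unl≡zipSum ocL πL) (unl≡zipSum ocR πR))))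
      dis-split : dis M Mπ P.≡ dis ocL πL +ℕ dis ocR πR
      dis-split = P.trans (dis≡zipSum M Mπ) (P.trans (zipSum-interleave-shift _ l pt ocL ocR πL πR (NP.∣m+n-m+o∣≡∣n-o∣ j) lenOcL lenπL lenOcR lenπR)
             (P.sym (P.cong₂ _+ℕ_ (dis≡zipSum ocL πL) (dis≡zipSum ocR πR))))
      PL = pow p fL
      PR = pow p fR
      QL = pow q bL
      QR = pow q bR
      XL = pow x (unl ocL πL)
      XR = pow x (unl ocR πR)
      YL = pow y (dis ocL πL)
      YR = pow y (dis ocR πR)
      ZL = pow z (des (inv l ocL))
      Zr = pow z (sgn r)
      ZR = pow z (des (inv r ocR))
      rightWeight = pow w (rlm (inv r ocR))

    splitFactor : ℕ → ℕ → Carrier → Carrier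
    splitFactor l r w = P' p l x y z 1# * P' p r x y z w * (pow z (sgn r) * w)

    leftWeight : ℕ → List ℕ → History → Carrier
    leftWeight l = weight p l x y z 1#

    rightWeight : ℕ → Carrier → List ℕ → History → Carrier
    rightWeight r w = weight p r x y z w

    pairSum-factor : ∀ l r w pt πL πR → lefts pt P.≡ l → rights pt P.≡ r → Word l (lefts pt) πL → Word r (rights pt) πR →
      pairSum l r [] [] (prefixWeight l r w) pt πL πR ≈ ∑ (run l [] πL) (leftWeight l πL) * ∑ (run r [] πR) (rightWeight r w πR) * (pow z (sgn r) * w)
    pairSum-factor l r w pt πL πR eL eR (pL , lL) (pR , lR) = trans
      (∑-cong-All (run l [] πL) (run-valid l [] πL pL) (λ hL okL → ∑-cong-All (run r [] πR) (run-valid r [] πR pR) (λ hR okR →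
        prefixWeight-interleave l r w pt πL πR (proj₁ hL) (proj₁ (proj₂ hL)) (proj₂ (proj₂ hL)) (proj₁ hR) (proj₁ (proj₂ hR)) (proj₂ (proj₂ hR))
          eL eR (proj₁ okL) (P.trans (proj₂ okL) (P.trans lL eL)) (P.trans lL eL) (proj₁ okR) (P.trans (proj₂ okR) (P.trans lR eR)) (P.trans lR eR))))
      (∑∑-* (run l [] πL) (run r [] πR) (leftWeight l πL) (rightWeight r w πR) (pow z (sgn r) * w))

    patternSum-value : ∀ l r w pt → lefts pt +ℕ rights pt P.≡ l +ℕ r → patternSum l r [] [] (prefixWeight l r w) pt ≈ (if lefts pt ≡ᵇ l then splitFactor l r w else 0#)
    patternSum-value l r w pt e with lefts pt ≡ᵇ l in eb
    ... | true = begin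
        ∑ wLl (λ πL → ∑ wRr (λ πR → pairSum l r [] [] (prefixWeight l r w) pt πL πR))
          ≈⟨ ∑-cong-All wLl (words-valid l (lefts pt)) (λ πL okL → ∑-cong-All wRr (words-valid r (rights pt)) (λ πR okR → pairSum-factor l r w pt πL πR eL eR okL okR)) ⟩
        ∑ wLl (λ πL → ∑ wRr (λ πR → ∑ (run l [] πL) (leftWeight l πL) * ∑ (run r [] πR) (rightWeight r w πR) * Kz))
          ≈⟨ ∑∑-* wLl wRr (λ πL → ∑ (run l [] πL) (leftWeight l πL)) (λ πR → ∑ (run r [] πR) (rightWeight r w πR)) Kz ⟩
        ∑ wLl (λ πL → ∑ (run l [] πL) (leftWeight l πL)) * ∑ wRr (λ πR → ∑ (run r [] πR) (rightWeight r w πR)) * Kz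
          ≈⟨ *-congʳ (*-cong (trans (∑-≡ _ (P.cong (words (spots l)) eL)) (sym (P'≈∑ p l x y z 1#)))
                            (trans (∑-≡ _ (P.cong (words (spots r)) eR)) (sym (P'≈∑ p r x y z w)))) ⟩
        splitFactor l r w ∎
      where
      eL = ≡ᵇ-true⇒≡ _ _ eb
      eR = NP.+-cancelˡ-≡ l (rights pt) r (P.subst (λ u → u +ℕ rights pt P.≡ l +ℕ r) eL e)
      wLl = words (spots l) (lefts pt)
      wRr = words (spots r) (rights pt)
      Kz = pow z (sgn r) * w
    ... | false with NP.<-cmp (lefts pt) l
    ...   | tri≈ _ eq _ = ⊥-elim (≡ᵇ-false⇒≢ eb eq)
    ...   | tri> _ _ l<lefts = patternSum-vanishes l r pt (prefixWeight l r w) (λ πL πR (pL , lenL) _ →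
              ∑-run-overfull l πL _ pL (P.subst (l <_) (P.sym lenL) l<lefts))
    ...   | tri< lefts<l _ _ = patternSum-vanishes l r pt (prefixWeight l r w) (λ πL πR _ (pR , lenR) →
              trans (∑-cong (run l [] πL) (λ hL → ∑-run-overfull r πR _ pR (P.subst (r <_) (P.sym lenR) r<rights))) (∑-0 (run l [] πL)))
      where
      r<rights : r < rights pt
      r<rights = NP.≰⇒> (λ rights≤r → NP.<-irrefl e (NP.+-mono-<-≤ lefts<l rights≤r))

    freeSpotSum : ℕ → ℕ → Carrier → Carrier
    freeSpotSum n l w = ∑ (words (spots (suc n)) n) (λ π → ∑ (run (suc n) [] π) (λ h → if mem (suc l) (outcome h) then 0# else lastCarSum (suc n) w π h))

    if-* : ∀ b X Y k → (b P.≡ false → X ≈ k * Y) → (if b then 0# else X) ≈ k * (if b then 0# else Y)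
    if-* true X Y k h = sym (zeroʳ k)
    if-* false X Y k h = h P.refl

    freeSpotSum-factor : ∀ n l r w → n P.≡ l +ℕ r → freeSpotSum n l w ≈ lastCarFactor l r * (nat (n C l) * splitFactor l r w)
    freeSpotSum-factor .(l +ℕ r) l r w P.refl = begin
      freeSpotSum n l w
        ≈⟨ ∑-cong-All (words (spots N) n) (words-valid N n) (λ π okπ → ∑-cong-All (run N [] π) (run-valid N [] π (proj₁ okπ)) (λ h okh →
             if-* (mem j (outcome h)) (lastCarSum (suc n) w π h) (prefixWeight l r w π h) (lastCarFactor l r) (λ em →
               lastCarSum-factor l r w π (proj₁ h) (proj₁ (proj₂ h)) (proj₂ (proj₂ h)) (proj₁ okh) (P.trans (proj₂ okh) (proj₂ okπ)) (proj₂ okπ) em))) ⟩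
      ∑ (words (spots N) n) (λ π → ∑ (run N [] π) (λ h → lastCarFactor l r * ifFree j (prefixWeight l r w) π h))
        ≈⟨ ∑-cong (words (spots N) n) (λ π → sym (∑-*ˡ (lastCarFactor l r) (run N [] π) _)) ⟩
      ∑ (words (spots N) n) (λ π → lastCarFactor l r * ∑ (run N [] π) (ifFree j (prefixWeight l r w) π))
        ≈⟨ sym (∑-*ˡ (lastCarFactor l r) (words (spots N) n) _) ⟩
      lastCarFactor l r * guardedSum l r n [] (prefixWeight l r w)
        ≈⟨ *-congˡ (splitAtFreeSpot l r n [] [] [] (prefixWeight l r w) (Splits-[] l r)) ⟩
      lastCarFactor l r * interleavedSum l r n [] [] (prefixWeight l r w)
        ≈⟨ *-congˡ (trans (∑-cong-All (patterns n) (patterns-length n) (λ pt e → patternSum-value l r w pt e)) (∑-patterns-lefts n l (splitFactor l r w))) ⟩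
      lastCarFactor l r * (nat (n C l) * splitFactor l r w) ∎
      where
      n = l +ℕ r
      N = suc l +ℕ r
      j = suc l

    P'-suc-lastCar : ∀ n w → P' p (suc n) x y z w ≈ ∑ (words (spots (suc n)) n) (λ π → ∑ (run (suc n) [] π) (lastCarSum (suc n) w π))
    P'-suc-lastCar n w = begin
      P' p N x y z w ≈⟨ P'≈∑ p N x y z w ⟩
      ∑ (words (spots N) N) (λ π → ∑ (run N [] π) (W π)) ≈⟨ ∑-words-∷ʳ (spots N) n _ ⟩
      ∑ (words (spots N) n) (λ π → ∑ (spots N) (λ a → ∑ (run N [] (π ++ [ a ])) (W (π ++ [ a ]))))
        ≈⟨ ∑-cong (words (spots N) n) (λ π → ∑-cong (spots N) (λ a → ∑-run-∷ʳ N [] π a (W (π ++ [ a ])))) ⟩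
      ∑ (words (spots N) n) (λ π → ∑ (spots N) (λ a → ∑ (run N [] π) (λ h → ∑ (step N (reverse (outcome h)) a) (λ cs → W (π ++ [ a ]) (snocHistory h cs)))))
        ≈⟨ ∑-cong (words (spots N) n) (λ π → ∑-swap (spots N) (run N [] π) _) ⟩
      ∑ (words (spots N) n) (λ π → ∑ (run N [] π) (lastCarSum N w π)) ∎
      where
      N = suc n
      W = weight p N x y z w

    -- Exactly one spot is left free, so summing the indicator of freeness over all spots
    -- inserts a factor 1.
    lastCar-byFreeSpot : ∀ n w → ∑ (words (spots (suc n)) n) (λ π → ∑ (run (suc n) [] π) (lastCarSum (suc n) w π)) ≈ ∑ (spots (suc n)) (λ j → freeSpotSum n (j ∸ 1) w)
    lastCar-byFreeSpot n w = begin
      ∑ (words (spots N) n) (λ π → ∑ (run N [] π) (lastCarSum N w π))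
        ≈⟨ ∑-cong-All (words (spots N) n) (words-valid N n) (λ π okπ → ∑-cong-All (run N [] π) (run-valid N [] π (proj₁ okπ)) (λ h okh →
             sym (trans (∑-if-mem (spots N) (outcome h) (lastCarSum N w π h))
                    (trans (*-congʳ (reflexive (P.cong nat (oneSpotFree n (outcome h) (proj₁ okh) (P.trans (proj₂ okh) (proj₂ okπ)))))) (nat-1-* _))))) ⟩
      ∑ (words (spots N) n) (λ π → ∑ (run N [] π) (λ h → ∑ (spots N) (λ j → if mem j (outcome h) then 0# else lastCarSum N w π h)))
        ≈⟨ ∑-cong (words (spots N) n) (λ π → ∑-swap (run N [] π) (spots N) _) ⟩
      ∑ (words (spots N) n) (λ π → ∑ (spots N) (λ j → ∑ (run N [] π) (λ h → if mem j (outcome h) then 0# else lastCarSum N w π h)))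
        ≈⟨ ∑-swap (words (spots N) n) (spots N) _ ⟩
      ∑ (spots N) (λ j → ∑ (words (spots N) n) (λ π → ∑ (run N [] π) (λ h → if mem j (outcome h) then 0# else lastCarSum N w π h)))
        ≈⟨ ∑-cong-All (spots N) (All-spots N) (λ { (suc j') _ → refl }) ⟩
      ∑ (spots N) (λ j → freeSpotSum n (j ∸ 1) w) ∎
      where
      N = suc n

    byFreeSpot-split : ∀ n w → ∑ (spots (suc n)) (λ j → freeSpotSum n (j ∸ 1) w) ≈ ∑ (upTo n) (λ i → freeSpotSum n i w) + (freeSpotSum n n w + 0#)
    byFreeSpot-split n w = trans (∑-spots (suc n) _) (trans (∑-≡ (λ i → freeSpotSum n i w) (P.sym (upTo-∷ʳ n))) (∑-++ (upTo n) [ n ] _))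

    P'-zero : ∀ w → P' p 0 x y z w ≈ 1#
    P'-zero w = trans (+-identityʳ _) (solve 0 (con 1 :* con 1 :* con 1 :* con 1 :* con 1 :* con 1 := con 1) refl)

    freeSpotSum-inner : ∀ n w i → i < n → freeSpotSum n i w ≈ nat (n C i) * (1# + p * xyGeom x y i + q * xyGeom x y (n ∸ i)) * z * w * P' p i x y z 1# * P' p (n ∸ i) x y z w
    freeSpotSum-inner n w i i<n = begin
      freeSpotSum n i w ≈⟨ freeSpotSum-factor n i (n ∸ i) w (P.sym (NP.m+[n∸m]≡n (NP.<⇒≤ i<n))) ⟩
      lastCarFactor i r * (nat (n C i) * (A * B * (pow z (sgn r) * w))) ≡⟨ P.cong (λ u → lastCarFactor i r * (nat (n C i) * (A * B * (pow z u * w)))) (sgn-∸ i<n) ⟩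
      lastCarFactor i r * (nat (n C i) * (A * B * ((z * 1#) * w))) ≈⟨ *-congʳ (lastCarFactor-closed i r) ⟩
      Lc * (Cn * (A * B * ((z * 1#) * w))) ≈⟨ solve 6 (λ Lc Cn A B Z W → Lc :* (Cn :* (A :* B :* ((Z :* con 1) :* W))) := Cn :* Lc :* Z :* W :* A :* B) refl Lc Cn A B z w ⟩
      Cn * Lc * z * w * A * B ∎
      where
      r = n ∸ i
      A = P' p i x y z 1#
      B = P' p r x y z w
      Cn = nat (n C i)
      Lc = 1# + p * xyGeom x y i + q * xyGeom x y r

    freeSpotSum-last : ∀ n w → freeSpotSum n n w ≈ (1# + p * xyGeom x y n) * w * P' p n x y z 1#
    freeSpotSum-last n w = begin
      freeSpotSum n n w ≈⟨ freeSpotSum-factor n n 0 w (P.sym (NP.+-identityʳ n)) ⟩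
      lastCarFactor n 0 * (nat (n C n) * (A * P' p 0 x y z w * (pow z 0 * w))) ≡⟨ P.cong (λ u → lastCarFactor n 0 * (nat u * (A * P' p 0 x y z w * (pow z 0 * w)))) (nCn≡1 n) ⟩
      lastCarFactor n 0 * (nat 1 * (A * P' p 0 x y z w * (1# * w))) ≈⟨ *-cong (trans (lastCarFactor-closed n 0) (trans (+-congˡ (zeroʳ q)) (+-identityʳ _))) (trans (nat-1-* _) (*-congʳ (*-congˡ (P'-zero w)))) ⟩
      (1# + p * xyGeom x y n) * (A * 1# * (1# * w)) ≈⟨ solve 3 (λ G A W → (con 1 :+ G) :* (A :* con 1 :* (con 1 :* W)) := (con 1 :+ G) :* W :* A) refl (p * xyGeom x y n) A w ⟩
      (1# + p * xyGeom x y n) * w * A ∎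
      where
      A = P' p n x y z 1#

theorem2p1 : ∀ {c ℓ} (R : CommutativeRing c ℓ) →
  let open CommutativeRing R
      open Gen R
  in (p x y z w : Carrier) (n : ℕ) →
     P' p (suc n) x y z w
       ≈ (1# + p * xyGeom x y n) * w * P' p n x y z 1#
         + sumR (map (λ i → nat (n C i)
                             * (1# + p * xyGeom x y i + (1# + - p) * xyGeom x y (n ∸ i))
                             * z * w * P' p i x y z 1# * P' p (n ∸ i) x y z w)
                     (upTo n))
theorem2p1 R p x y z w n = begin
  P' p (suc n) x y z w
    ≈⟨ P'-suc-lastCar n w ⟩
  ∑ (words (spots (suc n)) n) (λ π → ∑ (run (suc n) [] π) (lastCarSum (suc n) w π))
    ≈⟨ lastCar-byFreeSpot n w ⟩
  ∑ (spots (suc n)) (λ j → freeSpotSum n (j ∸ 1) w)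
    ≈⟨ byFreeSpot-split n w ⟩
  ∑ (upTo n) (λ i → freeSpotSum n i w) + (freeSpotSum n n w + 0#)
    ≈⟨ +-cong (∑-cong-All (upTo n) (all-upTo n) (freeSpotSum-inner n w)) (trans (+-identityʳ _) (freeSpotSum-last n w)) ⟩
  ∑ (upTo n) term + lastTerm
    ≈⟨ +-comm _ _ ⟩
  lastTerm + ∑ (upTo n) term
    ≡⟨ P.cong (lastTerm +_) (P.sym (sumR-map≡∑ (upTo n) term)) ⟩
  lastTerm + sumR (map term (upTo n)) ∎
  where
  open CommutativeRing R
  open Gen R
  open Parking using (spots; words)
  open FiniteSum R
  open Recurrence R
  open Terms p x y z
  open SetoidReasoning setoid
  lastTerm : Carrier
  lastTerm = (1# + p * xyGeom x y n) * w * P' p n x y z 1#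
  term : ℕ → Carrier
  term i = nat (n C i) * (1# + p * xyGeom x y i + (1# + - p) * xyGeom x y (n ∸ i)) * z * w * P' p i x y z 1# * P' p (n ∸ i) x y z w
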